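{- Let $h$ be the morphism on $\{0,1,2\}^*$ defined by $h(0)=01$, $h(1)=21$, $h(2)=0$, and let $\mathbf{p}$ be the infinite fixed point of $h$ beginning with $0$. For a positive integer $n$, $\mathbf{p}$ has a bispecial factor of length $n$ if and only if the $P4$ representation $(n)_P$ of $n$ belongs to $$\{1,11,110\}\ \cup\ (10)^+\{\epsilon,0\}\ \cup\ (1000)^+\{0,01,011,0110\}.$$
   Context: Define $X_1=1$, $X_2=2$, $X_3=4$, $X_4=7$, and $X_n=X_{n-1}+X_{n-2}+X_{n-4}$ for $n\geq 5$. Every natural number $N$ has a unique representation $N=\sum_{i=1}^{t}e_iX_i$ with $e_i\in\{0,1\}$, $e_t=1$, such that the binary string $e_te_{t-1}\cdots e_1$ contains no occurrence of $111$ or $1101$ (the greedy representation); this string is $(N)_P$. Regular-expression notation is used: $(10)^+$ is the set of nonempty concatenations of copies of $10$, $\epsilon$ is the empty word, and juxtaposition of sets denotes concatenation. A factor $w$ of $\mathbf{p}$ is right-special (resp. left-special) if there are distinct letters $a,b$ with $wa,wb$ (resp. $aw,bw$) both factors of $\mathbf{p}$; it is bispecial if it is both. -}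

module Defs where

open import Data.Nat using (ℕ; zero; suc; _+_; _∸_; _≤ᵇ_)
open import Data.Bool using (Bool; true; false; if_then_else_)
open import Data.Fin using (Fin; zero; suc)
open import Data.List using (List; []; _∷_; _++_; concatMap; length)
open import Data.Product using (Σ; _×_; ∃; ∃-syntax)
open import Relation.Binary.PropositionalEquality using (_≡_; _≢_)

Letter : Set
Letter = Fin 3

l0 l1 l2 : Letter
l0 = zero
l1 = suc zero
l2 = suc (suc zero)

h : Letter → List Letter
h zero = l0 ∷ l1 ∷ []
h (suc zero) = l2 ∷ l1 ∷ []
h (suc (suc zero)) = l0 ∷ []

hw : List Letter → List Letter
hw = concatMap h

hpow : ℕ → List Letter
hpow zero = l0 ∷ []
hpow (suc k) = hw (hpow k)

nth : List Letter → ℕ → Letter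
nth [] _ = l0
nth (a ∷ _) zero = a
nth (_ ∷ w) (suc i) = nth w i

-- The infinite fixed point p = lim h^k(0): the i-th letter (0-indexed) is the
-- i-th letter of h^(i+1)(0), which has length > i and is a prefix of p.
p : ℕ → Letter
p i = nth (hpow (suc i)) i

slice : ℕ → ℕ → List Letter
slice i zero = []
slice i (suc n) = p i ∷ slice (suc i) n

Factor : List Letter → Set
Factor w = ∃[ i ] slice i (length w) ≡ w

RightSpecial : List Letter → Set
RightSpecial w = ∃[ a ] ∃[ b ] (a ≢ b × Factor (w ++ a ∷ []) × Factor (w ++ b ∷ []))

LeftSpecial : List Letter → Set
LeftSpecial w = ∃[ a ] ∃[ b ] (a ≢ b × Factor (a ∷ w) × Factor (b ∷ w))

Bispecial : List Letter → Set
Bispecial w = RightSpecial w × LeftSpecial w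

HasBispecialOfLength : ℕ → Set
HasBispecialOfLength n = ∃[ w ] (length w ≡ n × Bispecial w)

-- X_1 = 1, X_2 = 2, X_3 = 4, X_4 = 7, X_n = X_{n-1} + X_{n-2} + X_{n-4}
-- (X 0 is an unused placeholder.)
X : ℕ → ℕ
X zero = 0
X (suc zero) = 1
X (suc (suc zero)) = 2
X (suc (suc (suc zero))) = 4
X (suc (suc (suc (suc zero)))) = 7
X (suc (suc (suc (suc (suc n))))) =
  X (suc (suc (suc (suc n)))) + X (suc (suc (suc n))) + X (suc n)

greedyDigits : ℕ → ℕ → List Bool
greedyDigits zero r = []
greedyDigits (suc k) r =
  if X (suc k) ≤ᵇ r
  then true ∷ greedyDigits k (r ∸ X (suc k))
  else false ∷ greedyDigits k r

dropLeadingZeros : List Bool → List Bool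
dropLeadingZeros [] = []
dropLeadingZeros (false ∷ w) = dropLeadingZeros w
dropLeadingZeros (true ∷ w) = true ∷ w

-- (N)_P : the greedy representation e_t ... e_1 (most significant digit first).
-- Since X_i ≥ i, positions 1..N suffice for N.
repP : ℕ → List Bool
repP N = dropLeadingZeros (greedyDigits N N)

-- The language
--  {1,11,110} ∪ (10)^+{ε,0} ∪ (1000)^+{0,01,011,0110}
-- (true = 1, false = 0)
data EpsOr0 : List Bool → Set where
  eps  : EpsOr0 []
  zer  : EpsOr0 (false ∷ [])

data TenPlus : List Bool → Set where
  base : ∀ {s} → EpsOr0 s → TenPlus (true ∷ false ∷ s)
  step : ∀ {w} → TenPlus w → TenPlus (true ∷ false ∷ w)

data ThouSuffix : List Bool → Set where
  s0    : ThouSuffix (false ∷ [])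
  s01   : ThouSuffix (false ∷ true ∷ [])
  s011  : ThouSuffix (false ∷ true ∷ true ∷ [])
  s0110 : ThouSuffix (false ∷ true ∷ true ∷ false ∷ [])

data ThouPlus : List Bool → Set where
  base : ∀ {s} → ThouSuffix s → ThouPlus (true ∷ false ∷ false ∷ false ∷ s)
  step : ∀ {w} → ThouPlus w → ThouPlus (true ∷ false ∷ false ∷ false ∷ w)

data InL : List Bool → Set where
  w1    : InL (true ∷ [])
  w11   : InL (true ∷ true ∷ [])
  w110  : InL (true ∷ true ∷ false ∷ [])
  ten   : ∀ {w} → TenPlus w → InL w
  thou  : ∀ {w} → ThouPlus w → InL w

-- The factors of length 2 of p are 01, 02, 10, 12, 21, and h is injective. Put
-- lift v = s h(v) t, where s = 1 unless v starts with 1, and t = 0 if v ends with 1 (else empty).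
-- Pushing a two-sided extension c v d through h gives an extension of lift v, distinct letters
-- giving distinct letters, so lift maps bispecial factors to bispecial factors. Conversely, every
-- bispecial factor other than 1 and 10 is s m t with m ending in 1 and not starting with 1; such an
-- m is the image of a unique v and every occurrence of it is aligned with the cuts of h, so the
-- extensions of s m t come from extensions of v, which is therefore bispecial and forces s and t.
-- Hence the bispecial factors are exactly lift^q(1) and lift^q(10). Counting letters, their lengths
-- obey the same recurrences as the values of the strings 1, 11, 110, (1000)^+{0,01,011,0110} and
-- (10)^+{ε,0} taken in order, and these strings avoid 111 and 1101, so they are the greedy
-- representations.

module Submission where

open import Defs
open import Data.Nat using (ℕ; suc)
open import Function.Bundles using (_⇔_)

open import Data.Nat using (zero; _+_; _*_; _∸_; _≤_; _<_; z≤n; s≤s; _≤ᵇ_)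
open import Data.Nat.Properties
open import Data.Nat.Tactic.RingSolver using (solve-∀)
open import Data.Fin using (zero; suc)
open import Data.Bool using (Bool; true; false; not; T)
open import Data.Bool.Properties using (not-involutive)
open import Data.List using (List; []; _∷_; _++_; length; _∷ʳ_; take; drop; replicate; initLast; _∷ʳ′_)
open import Data.List.Properties
  using (++-assoc; ++-identityʳ; length-++; length-++-≤ˡ; concatMap-++; take++drop≡id; ∷-injective; ∷-injectiveˡ; ∷-injectiveʳ; ∷ʳ-injective; ++-conicalˡ; ++-conicalʳ)
open import Data.List.Relation.Unary.Linked as Linked using (Linked; []; [-]; _∷_)
open import Data.Product using (_×_; _,_; proj₁; proj₂; ∃; ∃-syntax)
open import Data.Sum using (_⊎_; inj₁; inj₂)
open import Data.Unit using (⊤; tt)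
open import Data.Empty using (⊥; ⊥-elim)
open import Function using (_∘_)
open import Function.Bundles using (mk⇔)
open import Relation.Binary.Core using (Rel)
open import Relation.Binary.PropositionalEquality

cong₃ : ∀ {A B C D : Set} (f : A → B → C → D) {a a' b b' c c'} →
        a ≡ a' → b ≡ b' → c ≡ c' → f a b c ≡ f a' b' c'
cong₃ f refl refl refl = refl

retraction⇒injective : ∀ {A B : Set} (f : A → B) (g : B → A) → (∀ x → g (f x) ≡ x) →
                       ∀ {x y} → f x ≡ f y → x ≡ y
retraction⇒injective f g gf {x} {y} e = trans (sym (gf x)) (trans (cong g e) (gf y))

snoc-view : ∀ {A : Set} (b : A) r → ∃[ u ] ∃[ c ] b ∷ r ≡ u ∷ʳ c
snoc-view b [] = [] , b , refl
snoc-view b (b' ∷ r) with snoc-view b' r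
... | u , c , e = b ∷ u , c , cong (b ∷_) e

module _ {a ℓ} {A : Set a} {R : Rel A ℓ} where

  linked-++⁻ˡ : ∀ xs {ys} → Linked R (xs ++ ys) → Linked R xs
  linked-++⁻ˡ [] _ = []
  linked-++⁻ˡ (x ∷ []) _ = [-]
  linked-++⁻ˡ (x ∷ y ∷ xs) (r ∷ l) = r ∷ linked-++⁻ˡ (y ∷ xs) l

  linked-++⁻ʳ : ∀ xs {ys} → Linked R (xs ++ ys) → Linked R ys
  linked-++⁻ʳ [] l = l
  linked-++⁻ʳ (x ∷ xs) l = linked-++⁻ʳ xs (Linked.tail l)

-- Factors of p

-- Factors of p are handled as occurrences in some h^k(0): equivalent to `Factor` (occurs⇒factor,
-- factor⇒occurs) and much easier to push through h.
Occurs : List Letter → Set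
Occurs w = ∃[ k ] ∃[ x ] ∃[ y ] hpow k ≡ x ++ w ++ y

hw-++ : ∀ x y → hw (x ++ y) ≡ hw x ++ hw y
hw-++ = concatMap-++ h

hw-∷ʳ : ∀ w c → hw (w ∷ʳ c) ≡ hw w ++ h c
hw-∷ʳ w c = trans (hw-++ w (c ∷ [])) (cong (hw w ++_) (++-identityʳ (h c)))

hpow-starts-with-0 : ∀ k → ∃[ r ] hpow k ≡ l0 ∷ r
hpow-starts-with-0 zero = [] , refl
hpow-starts-with-0 (suc k) with hpow-starts-with-0 k
... | r , eq = l1 ∷ hw r , cong hw eq

hpow-prefix : ∀ k d → ∃[ z ] hpow (k + d) ≡ hpow k ++ z
hpow-prefix zero d = hpow-starts-with-0 d
hpow-prefix (suc k) d with hpow-prefix k d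
... | z , eq = hw z , trans (cong hw eq) (hw-++ (hpow k) z)

length-≤-hw : ∀ w → length w ≤ length (hw w)
length-≤-hw [] = z≤n
length-≤-hw (zero ∷ w) = m≤n⇒m≤1+n (s≤s (length-≤-hw w))
length-≤-hw (suc zero ∷ w) = m≤n⇒m≤1+n (s≤s (length-≤-hw w))
length-≤-hw (suc (suc zero) ∷ w) = s≤s (length-≤-hw w)

k<length-hpow : ∀ k → k < length (hpow k)
k<length-hpow zero = s≤s z≤n
k<length-hpow (suc k) = grows (hpow k) (k<length-hpow k) (hpow-starts-with-0 k)
  where
    grows : ∀ w → k < length w → ∃[ r ] w ≡ l0 ∷ r → suc k < length (hw w)
    grows .(l0 ∷ r) k<1+r (r , refl) = s≤s (≤-trans k<1+r (s≤s (length-≤-hw r)))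

nth-++ˡ : ∀ x y {i} → i < length x → nth (x ++ y) i ≡ nth x i
nth-++ˡ (a ∷ x) y {zero} _ = refl
nth-++ˡ (a ∷ x) y {suc i} (s≤s i<x) = nth-++ˡ x y i<x

nth-length : ∀ x a r → nth (x ++ a ∷ r) (length x) ≡ a
nth-length [] a r = refl
nth-length (b ∷ x) a r = nth-length x a r

p≡nth-hpow : ∀ K j → j < length (hpow K) → p j ≡ nth (hpow K) j
p≡nth-hpow K j j<K with hpow-prefix (suc j) K | hpow-prefix K (suc j)
... | z₁ , e₁ | z₂ , e₂ = begin
  nth (hpow (suc j)) j      ≡⟨ nth-++ˡ (hpow (suc j)) z₁ (<⇒≤ (k<length-hpow (suc j))) ⟨
  nth (hpow (suc j) ++ z₁) j ≡⟨ cong (λ u → nth u j) e₁ ⟨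
  nth (hpow (suc j + K)) j  ≡⟨ cong (λ m → nth (hpow m) j) (+-comm (suc j) K) ⟩
  nth (hpow (K + suc j)) j  ≡⟨ cong (λ u → nth u j) e₂ ⟩
  nth (hpow K ++ z₂) j      ≡⟨ nth-++ˡ (hpow K) z₂ j<K ⟩
  nth (hpow K) j            ∎
  where open ≡-Reasoning

slice-at-occurrence : ∀ K w x y → hpow K ≡ x ++ w ++ y → slice (length x) (length w) ≡ w
slice-at-occurrence K [] x y eq = refl
slice-at-occurrence K (a ∷ w) x y eq = cong₂ _∷_ head-letter rest
  where
    x<K : length x < length (hpow K)
    x<K = subst (λ u → length x < length u) (sym eq)
            (subst (length x <_) (sym (length-++ x)) (m<m+n (length x) (s≤s z≤n)))
    head-letter : p (length x) ≡ a
    head-letter = trans (p≡nth-hpow K (length x) x<K)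
                        (trans (cong (λ u → nth u (length x)) eq) (nth-length x a (w ++ y)))
    rest : slice (suc (length x)) (length w) ≡ w
    rest = subst (λ m → slice m (length w) ≡ w)
             (trans (length-++ x) (+-comm (length x) 1))
             (slice-at-occurrence K w (x ∷ʳ a) y (trans eq (sym (++-assoc x (a ∷ []) (w ++ y)))))

occurs⇒factor : ∀ {w} → Occurs w → Factor w
occurs⇒factor {w} (K , x , y , eq) = length x , slice-at-occurrence K w x y eq

drop-hpow : ∀ K n i → i + n ≤ length (hpow K) → drop i (hpow K) ≡ slice i n ++ drop (n + i) (hpow K)
drop-hpow K zero i _ = refl
drop-hpow K (suc n) i i+1+n≤K = trans (drop-nth (hpow K) i<K)
  (cong₂ _∷_ (sym (p≡nth-hpow K i i<K))
    (trans (drop-hpow K n (suc i) 1+i+n≤K)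
           (cong (λ m → slice (suc i) n ++ drop m (hpow K)) (+-suc n i))))
  where
    1+i+n≤K : suc i + n ≤ length (hpow K)
    1+i+n≤K = subst (_≤ length (hpow K)) (+-suc i n) i+1+n≤K
    i<K : i < length (hpow K)
    i<K = ≤-trans (s≤s (m≤m+n i n)) 1+i+n≤K
    drop-nth : ∀ L {i} → i < length L → drop i L ≡ nth L i ∷ drop (suc i) L
    drop-nth (a ∷ L) {zero} _ = refl
    drop-nth (a ∷ L) {suc i} (s≤s i<L) = drop-nth L i<L

factor⇒occurs : ∀ {w} → Factor w → Occurs w
factor⇒occurs {w} (i , eq) = K , take i (hpow K) , drop (length w + i) (hpow K) , (begin
  hpow K                                               ≡⟨ take++drop≡id i (hpow K) ⟨
  take i (hpow K) ++ drop i (hpow K)                   ≡⟨ cong (take i (hpow K) ++_) split-drop ⟩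
  take i (hpow K) ++ w ++ drop (length w + i) (hpow K) ∎)
  where
    open ≡-Reasoning
    K : ℕ
    K = i + length w
    split-drop : drop i (hpow K) ≡ w ++ drop (length w + i) (hpow K)
    split-drop = trans (drop-hpow K (length w) i (<⇒≤ (k<length-hpow K)))
                       (cong (_++ drop (length w + i) (hpow K)) eq)

data Allowed : Letter → Letter → Set where
  0⇾1 : Allowed l0 l1
  0⇾2 : Allowed l0 l2
  1⇾0 : Allowed l1 l0
  1⇾2 : Allowed l1 l2
  2⇾1 : Allowed l2 l1

linked-hw : ∀ {w} → Linked Allowed w → Linked Allowed (hw w)
linked-hw {[]} _ = []
linked-hw {zero ∷ []} _ = 0⇾1 ∷ [-]
linked-hw {suc zero ∷ []} _ = 2⇾1 ∷ [-]
linked-hw {suc (suc zero) ∷ []} _ = [-]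
linked-hw {a ∷ b ∷ w} (r ∷ l) = glue {w = w} r (linked-hw l)
  where
    glue : ∀ {a b w} → Allowed a b → Linked Allowed (hw (b ∷ w)) → Linked Allowed (hw (a ∷ b ∷ w))
    glue 0⇾1 l = 0⇾1 ∷ 1⇾2 ∷ l
    glue 0⇾2 l = 0⇾1 ∷ 1⇾0 ∷ l
    glue 1⇾0 l = 2⇾1 ∷ 1⇾0 ∷ l
    glue 1⇾2 l = 2⇾1 ∷ 1⇾0 ∷ l
    glue 2⇾1 l = 0⇾2 ∷ l

linked-hpow : ∀ k → Linked Allowed (hpow k)
linked-hpow zero = [-]
linked-hpow (suc k) = linked-hw (linked-hpow k)

occurs⇒linked : ∀ {w} → Occurs w → Linked Allowed w
occurs⇒linked {w} (k , x , y , eq) =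
  linked-++⁻ˡ w (linked-++⁻ʳ x (subst (Linked Allowed) eq (linked-hpow k)))

occurs⇒allowed : ∀ u a b v → Occurs (u ++ a ∷ b ∷ v) → Allowed a b
occurs⇒allowed u a b v occ = Linked.head (linked-++⁻ʳ u (occurs⇒linked occ))

occurs-infix : ∀ x w y → Occurs (x ++ w ++ y) → Occurs w
occurs-infix x w y (k , x' , y' , eq) = k , x' ++ x , y ++ y' , (begin
  hpow k                     ≡⟨ eq ⟩
  x' ++ (x ++ w ++ y) ++ y'  ≡⟨ cong (x' ++_) (trans (++-assoc x (w ++ y) y') (cong (x ++_) (++-assoc w y y'))) ⟩
  x' ++ x ++ w ++ y ++ y'    ≡⟨ ++-assoc x' x (w ++ y ++ y') ⟨
  (x' ++ x) ++ w ++ y ++ y'  ∎)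
  where open ≡-Reasoning

occurs-prefix : ∀ w y → Occurs (w ++ y) → Occurs w
occurs-prefix w y = occurs-infix [] w y

occurs-suffix : ∀ x w → Occurs (x ++ w) → Occurs w
occurs-suffix x w occ = occurs-infix x w [] (subst Occurs (cong (x ++_) (sym (++-identityʳ w))) occ)

occurs-hw : ∀ {w} → Occurs w → Occurs (hw w)
occurs-hw {w} (k , x , y , eq) = suc k , hw x , hw y ,
  trans (cong hw eq) (trans (hw-++ x (w ++ y)) (cong (hw x ++_) (hw-++ w y)))

occurs-extendʳ : ∀ {w} → Occurs w → ∃[ b ] Occurs (w ∷ʳ b)
occurs-extendʳ {w} occ with occurs⇒factor occ
... | i , eq = p (length w + i) , factor⇒occurs (i , (begin
  slice i (length (w ∷ʳ p (length w + i)))  ≡⟨ cong (slice i) (trans (length-++ w) (+-comm (length w) 1)) ⟩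
  slice i (suc (length w))                  ≡⟨ slice-∷ʳ (length w) i ⟩
  slice i (length w) ∷ʳ p (length w + i)    ≡⟨ cong (_∷ʳ p (length w + i)) eq ⟩
  w ∷ʳ p (length w + i)                     ∎))
  where
    open ≡-Reasoning
    slice-∷ʳ : ∀ n i → slice i (suc n) ≡ slice i n ∷ʳ p (n + i)
    slice-∷ʳ zero i = refl
    slice-∷ʳ (suc n) i = cong (p i ∷_) (trans (slice-∷ʳ n (suc i)) (cong (λ m → slice (suc i) n ∷ʳ p m) (+-suc n i)))

hw^ : ℕ → List Letter → List Letter
hw^ zero w = w
hw^ (suc n) w = hw (hw^ n w)

hw^-++ : ∀ n x y → hw^ n (x ++ y) ≡ hw^ n x ++ hw^ n y
hw^-++ zero x y = refl
hw^-++ (suc n) x y = trans (cong hw (hw^-++ n x y)) (hw-++ (hw^ n x) (hw^ n y))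

hw^-0 : ∀ n → hw^ n (l0 ∷ []) ≡ hpow n
hw^-0 zero = refl
hw^-0 (suc n) = cong hw (hw^-0 n)

hw^-nonempty : ∀ n a → ∃[ b ] ∃[ r ] hw^ n (a ∷ []) ≡ b ∷ r
hw^-nonempty zero a = a , [] , refl
hw^-nonempty (suc n) a with hw^-nonempty n a
... | zero , r , e = l0 , l1 ∷ hw r , cong hw e
... | suc zero , r , e = l2 , l1 ∷ hw r , cong hw e
... | suc (suc zero) , r , e = l0 , hw r , cong hw e

occurs-hw^ : ∀ n {w} → Occurs w → Occurs (hw^ n w)
occurs-hw^ zero occ = occ
occurs-hw^ (suc n) occ = occurs-hw (occurs-hw^ n occ)

-- hpow 3 = 0121021 contains 10, so h^k(1) h^k(0) occurs and its last letter precedes hpow k.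
letter-before-hpow : ∀ k → ∃[ c ] Occurs (c ∷ hpow k)
letter-before-hpow k with hw^-nonempty k l1
... | b , r , e₁ with snoc-view b r
... | u , c , e₂ = c , occurs-suffix u (c ∷ hpow k) (subst Occurs image-of-10 (occurs-hw^ k 10-occurs))
  where
    10-occurs : Occurs (l1 ∷ l0 ∷ [])
    10-occurs = 3 , l0 ∷ l1 ∷ l2 ∷ [] , l2 ∷ l1 ∷ [] , refl
    image-of-10 : hw^ k (l1 ∷ l0 ∷ []) ≡ u ++ c ∷ hpow k
    image-of-10 = begin
      hw^ k (l1 ∷ l0 ∷ [])                ≡⟨ hw^-++ k (l1 ∷ []) (l0 ∷ []) ⟩
      hw^ k (l1 ∷ []) ++ hw^ k (l0 ∷ [])  ≡⟨ cong₂ _++_ (trans e₁ e₂) (hw^-0 k) ⟩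
      (u ∷ʳ c) ++ hpow k                  ≡⟨ ++-assoc u (c ∷ []) (hpow k) ⟩
      u ++ c ∷ hpow k                     ∎
      where open ≡-Reasoning

occurs-extendˡ : ∀ {w} → Occurs w → ∃[ a ] Occurs (a ∷ w)
occurs-extendˡ {w} (k , x , y , eq) with initLast x
... | x' ∷ʳ′ c = c , k , x' , y , trans eq (++-assoc x' (c ∷ []) (w ++ y))
... | [] with letter-before-hpow k
... | c , occ = c , occurs-prefix (c ∷ w) y (subst (λ u → Occurs (c ∷ u)) eq occ)

occurs-in-image : ∀ {w} → Occurs w → ∃[ k ] ∃[ x ] ∃[ y ] hw (hpow k) ≡ x ++ w ++ y
occurs-in-image {w} (k , x , y , eq) with hpow-prefix k 1
... | z , e = k , x , y ++ z , (begin
  hpow (suc k)        ≡⟨ cong hpow (+-comm 1 k) ⟩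
  hpow (k + 1)        ≡⟨ e ⟩
  hpow k ++ z         ≡⟨ cong (_++ z) eq ⟩
  (x ++ w ++ y) ++ z  ≡⟨ ++-assoc x (w ++ y) z ⟩
  x ++ (w ++ y) ++ z  ≡⟨ cong (x ++_) (++-assoc w y z) ⟩
  x ++ w ++ y ++ z    ∎)
  where open ≡-Reasoning

-- Desubstitution

NoLeading1 : List Letter → Set
NoLeading1 (suc zero ∷ _) = ⊥
NoLeading1 _ = ⊤

HwSplit : List Letter → List Letter → List Letter → Set
HwSplit W x z = ∃[ W₁ ] ∃[ W₂ ] W ≡ W₁ ++ W₂ × hw W₁ ≡ x × hw W₂ ≡ z

split-∷ : ∀ c {W x z} → HwSplit W x z → HwSplit (c ∷ W) (h c ++ x) z
split-∷ c (W₁ , W₂ , e₁ , e₂ , e₃) = c ∷ W₁ , W₂ , cong (c ∷_) e₁ , cong (h c ++_) e₂ , e₃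

-- Every 1 of hw W ends an image h(c), so a position not followed by 1 is a cut between images.
hw-split : ∀ W x z → hw W ≡ x ++ z → NoLeading1 z → HwSplit W x z
hw-split W [] z e _ = [] , W , refl , refl , e
hw-split (zero ∷ W) (a ∷ []) z refl ()
hw-split (zero ∷ W) (a ∷ b ∷ x) z e nz with refl , e₁ ← ∷-injective e
  with refl , e₂ ← ∷-injective e₁ = split-∷ l0 (hw-split W x z e₂ nz)
hw-split (suc zero ∷ W) (a ∷ []) z refl ()
hw-split (suc zero ∷ W) (a ∷ b ∷ x) z e nz with refl , e₁ ← ∷-injective e
  with refl , e₂ ← ∷-injective e₁ = split-∷ l1 (hw-split W x z e₂ nz)
hw-split (suc (suc zero) ∷ W) (a ∷ x) z e nz with refl , e₁ ← ∷-injective e =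
  split-∷ l2 (hw-split W x z e₁ nz)

-- A left inverse of hw: in the image of h, a 0 followed by 1 can only come from h(0).
unhw : List Letter → List Letter
unhw (zero ∷ suc zero ∷ r) = l0 ∷ unhw r
unhw (zero ∷ r) = l2 ∷ unhw r
unhw (suc (suc zero) ∷ suc zero ∷ r) = l1 ∷ unhw r
unhw _ = []

unhw-0∷hw : ∀ v → unhw (l0 ∷ hw v) ≡ l2 ∷ unhw (hw v)
unhw-0∷hw [] = refl
unhw-0∷hw (zero ∷ v) = refl
unhw-0∷hw (suc zero ∷ v) = refl
unhw-0∷hw (suc (suc zero) ∷ v) = refl

unhw-hw : ∀ v → unhw (hw v) ≡ v
unhw-hw [] = refl
unhw-hw (zero ∷ v) = cong (l0 ∷_) (unhw-hw v)
unhw-hw (suc zero ∷ v) = cong (l1 ∷_) (unhw-hw v)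
unhw-hw (suc (suc zero) ∷ v) = trans (unhw-0∷hw v) (cong (l2 ∷_) (unhw-hw v))

hw-injective : ∀ {v v'} → hw v ≡ hw v' → v ≡ v'
hw-injective = retraction⇒injective hw unhw unhw-hw

no-1-after-1 : ∀ u z → Linked Allowed ((u ∷ʳ l1) ++ z) → NoLeading1 z
no-1-after-1 u (suc zero ∷ z) l with () ← Linked.head (linked-++⁻ʳ u (subst (Linked Allowed) (++-assoc u (l1 ∷ []) (l1 ∷ z)) l))
no-1-after-1 u [] _ = tt
no-1-after-1 u (zero ∷ z) _ = tt
no-1-after-1 u (suc (suc zero) ∷ z) _ = tt

no-leading1-++ : ∀ u a s → NoLeading1 (u ∷ʳ a) → NoLeading1 ((u ∷ʳ a) ++ s)
no-leading1-++ [] zero s _ = tt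
no-leading1-++ [] (suc zero) s ()
no-leading1-++ [] (suc (suc zero)) s _ = tt
no-leading1-++ (zero ∷ u) a s _ = tt
no-leading1-++ (suc zero ∷ u) a s ()
no-leading1-++ (suc (suc zero) ∷ u) a s _ = tt

Synchronizing : List Letter → Set
Synchronizing m = ∃[ u ] m ≡ u ∷ʳ l1 × NoLeading1 m

desubstitute : ∀ q m r → Synchronizing m → Occurs (q ++ m ++ r) →
  ∃[ k ] ∃[ W₁ ] ∃[ v ] ∃[ W₃ ] hpow k ≡ W₁ ++ v ++ W₃ × hw v ≡ m ×
    (∃[ X ] X ++ q ≡ hw W₁) × (∃[ Y ] hw W₃ ≡ r ++ Y)
desubstitute q .(u ∷ʳ l1) r (u , refl , m-cut) occ with occurs-in-image occ
... | k , x , y , eq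
  with hw-split (hpow k) (x ++ q) (m ++ r ++ y) (trans eq regroup) (no-leading1-++ u l1 (r ++ y) m-cut)
  where
    m : List Letter
    m = u ∷ʳ l1
    regroup : x ++ (q ++ m ++ r) ++ y ≡ (x ++ q) ++ m ++ r ++ y
    regroup = trans (cong (x ++_) (trans (++-assoc q (m ++ r) y) (cong (q ++_) (++-assoc m r y))))
                    (sym (++-assoc x q (m ++ r ++ y)))
... | W₁ , W₂ , hpow≡ , hW₁ , hW₂ with hw-split W₂ (u ∷ʳ l1) (r ++ y) hW₂ (no-1-after-1 u (r ++ y) linked)
  where
    linked : Linked Allowed ((u ∷ʳ l1) ++ r ++ y)
    linked = subst (Linked Allowed) hW₂ (linked-++⁻ʳ (hw W₁)
               (subst (Linked Allowed) (trans (cong hw hpow≡) (hw-++ W₁ W₂)) (linked-hpow (suc k))))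
... | v , W₃ , W₂≡ , hv , hW₃ =
  k , W₁ , v , W₃ , trans hpow≡ (cong (W₁ ++_) W₂≡) , hv , (x , sym hW₁) , (y , hW₃)

-- Bispecial factors

leftPad : Bool → List Letter
leftPad true = l1 ∷ []
leftPad false = []

rightPad : Bool → List Letter
rightPad true = l0 ∷ []
rightPad false = []

isOne : Letter → Bool
isOne (suc zero) = true
isOne _ = false

notOne : Letter → Bool
notOne (suc zero) = false
notOne _ = true

padsLeft : List Letter → Bool
padsLeft [] = true
padsLeft (a ∷ _) = notOne a

padsRight : List Letter → Bool
padsRight [] = false
padsRight (a ∷ []) = isOne a
padsRight (_ ∷ b ∷ r) = padsRight (b ∷ r)

padsRight-∷ʳ : ∀ u a → padsRight (u ∷ʳ a) ≡ isOne a
padsRight-∷ʳ [] a = refl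
padsRight-∷ʳ (x ∷ []) a = refl
padsRight-∷ʳ (x ∷ y ∷ u) a = padsRight-∷ʳ (y ∷ u) a

lift : List Letter → List Letter
lift v = leftPad (padsLeft v) ++ hw v ++ rightPad (padsRight v)

-- If c precedes v, then LeftLetter s c a says that a precedes leftPad s ++ hw v;
-- if d follows v, then RightLetter t d b says that b follows hw v ++ rightPad t.
LeftLetter : Bool → Letter → Letter → Set
LeftLetter false zero a = a ≡ l1
LeftLetter false (suc zero) a = a ≡ l1
LeftLetter false (suc (suc zero)) a = a ≡ l0
LeftLetter true zero a = a ≡ l0
LeftLetter true (suc zero) a = a ≡ l2
LeftLetter true (suc (suc zero)) a = ⊥

RightLetter : Bool → Letter → Letter → Set
RightLetter false zero b = b ≡ l0
RightLetter false (suc zero) b = b ≡ l2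
RightLetter false (suc (suc zero)) b = b ≡ l0
RightLetter true zero b = b ≡ l1
RightLetter true (suc zero) b = ⊥
RightLetter true (suc (suc zero)) b = b ≡ l2

left-letter-unique : ∀ s c {a a'} → LeftLetter s c a → LeftLetter s c a' → a ≡ a'
left-letter-unique false zero refl refl = refl
left-letter-unique false (suc zero) refl refl = refl
left-letter-unique false (suc (suc zero)) refl refl = refl
left-letter-unique true zero refl refl = refl
left-letter-unique true (suc zero) refl refl = refl
left-letter-unique true (suc (suc zero)) ()

right-letter-unique : ∀ t d {b b'} → RightLetter t d b → RightLetter t d b' → b ≡ b'
right-letter-unique false zero refl refl = refl
right-letter-unique false (suc zero) refl refl = refl
right-letter-unique false (suc (suc zero)) refl refl = refl
right-letter-unique true zero refl refl = refl
right-letter-unique true (suc zero) ()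
right-letter-unique true (suc (suc zero)) refl refl = refl

last-letter : ∀ xs ys {a b : Letter} → xs ∷ʳ a ≡ ys ∷ʳ b → a ≡ b
last-letter xs ys e = proj₂ (∷ʳ-injective xs ys e)

penultimate-letter : ∀ xs ys {a a' b b' : Letter} → xs ++ a ∷ a' ∷ [] ≡ ys ++ b ∷ b' ∷ [] → a ≡ b
penultimate-letter xs ys {a} {a'} {b} {b'} e = last-letter xs ys
  (proj₁ (∷ʳ-injective (xs ∷ʳ a) (ys ∷ʳ b) (trans (++-assoc xs _ _) (trans e (sym (++-assoc ys _ _))))))

left-letter : ∀ s c a X A → X ++ a ∷ leftPad s ≡ A ++ h c → LeftLetter s c a
left-letter false zero a X A e = last-letter X (A ∷ʳ l0) (trans e (sym (++-assoc A _ _)))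
left-letter false (suc zero) a X A e = last-letter X (A ∷ʳ l2) (trans e (sym (++-assoc A _ _)))
left-letter false (suc (suc zero)) a X A e = last-letter X A e
left-letter true zero a X A e = penultimate-letter X A e
left-letter true (suc zero) a X A e = penultimate-letter X A e
left-letter true (suc (suc zero)) a X A e with () ← last-letter (X ∷ʳ a) A (trans (++-assoc X _ _) e)

right-letter : ∀ t d b W Y → Linked Allowed (d ∷ W) → h d ++ hw W ≡ (rightPad t ∷ʳ b) ++ Y → RightLetter t d b
right-letter false zero b W Y _ e = sym (∷-injectiveˡ e)
right-letter false (suc zero) b W Y _ e = sym (∷-injectiveˡ e)
right-letter false (suc (suc zero)) b W Y _ e = sym (∷-injectiveˡ e)
right-letter true zero b W Y _ e = sym (∷-injectiveˡ (∷-injectiveʳ e))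
right-letter true (suc zero) b W Y _ ()
right-letter true (suc (suc zero)) b [] Y _ ()
right-letter true (suc (suc zero)) b (suc zero ∷ W) Y _ e = sym (∷-injectiveˡ (∷-injectiveʳ e))
right-letter true (suc (suc zero)) b (zero ∷ W) Y (() ∷ _) e
right-letter true (suc (suc zero)) b (suc (suc zero) ∷ W) Y (() ∷ _) e

left-pad-determined : ∀ s {c c' v₀ a a'} → LeftLetter s c a → LeftLetter s c' a' → a ≢ a' →
                      Allowed c v₀ → Allowed c' v₀ → s ≡ notOne v₀
left-pad-determined s ra ra' a≢a' 1⇾0 1⇾0 = ⊥-elim (a≢a' (left-letter-unique s l1 ra ra'))
left-pad-determined s ra ra' a≢a' 0⇾1 0⇾1 = ⊥-elim (a≢a' (left-letter-unique s l0 ra ra'))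
left-pad-determined s ra ra' a≢a' 2⇾1 2⇾1 = ⊥-elim (a≢a' (left-letter-unique s l2 ra ra'))
left-pad-determined s ra ra' a≢a' 0⇾2 0⇾2 = ⊥-elim (a≢a' (left-letter-unique s l0 ra ra'))
left-pad-determined s ra ra' a≢a' 1⇾2 1⇾2 = ⊥-elim (a≢a' (left-letter-unique s l1 ra ra'))
left-pad-determined false ra ra' a≢a' 0⇾1 2⇾1 = refl
left-pad-determined false ra ra' a≢a' 2⇾1 0⇾1 = refl
left-pad-determined false ra ra' a≢a' 0⇾2 1⇾2 = ⊥-elim (a≢a' (trans ra (sym ra')))
left-pad-determined false ra ra' a≢a' 1⇾2 0⇾2 = ⊥-elim (a≢a' (trans ra (sym ra')))
left-pad-determined true ra () a≢a' 0⇾1 2⇾1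
left-pad-determined true () ra' a≢a' 2⇾1 0⇾1
left-pad-determined true ra ra' a≢a' 0⇾2 1⇾2 = refl
left-pad-determined true ra ra' a≢a' 1⇾2 0⇾2 = refl

right-pad-determined : ∀ t {d d' vₗ b b'} → RightLetter t d b → RightLetter t d' b' → b ≢ b' →
                       Allowed vₗ d → Allowed vₗ d' → t ≡ isOne vₗ
right-pad-determined t rb rb' b≢b' 0⇾1 0⇾1 = ⊥-elim (b≢b' (right-letter-unique t l1 rb rb'))
right-pad-determined t rb rb' b≢b' 0⇾2 0⇾2 = ⊥-elim (b≢b' (right-letter-unique t l2 rb rb'))
right-pad-determined t rb rb' b≢b' 1⇾0 1⇾0 = ⊥-elim (b≢b' (right-letter-unique t l0 rb rb'))
right-pad-determined t rb rb' b≢b' 1⇾2 1⇾2 = ⊥-elim (b≢b' (right-letter-unique t l2 rb rb'))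
right-pad-determined t rb rb' b≢b' 2⇾1 2⇾1 = ⊥-elim (b≢b' (right-letter-unique t l1 rb rb'))
right-pad-determined false rb rb' b≢b' 0⇾1 0⇾2 = refl
right-pad-determined false rb rb' b≢b' 0⇾2 0⇾1 = refl
right-pad-determined false rb rb' b≢b' 1⇾0 1⇾2 = ⊥-elim (b≢b' (trans rb (sym rb')))
right-pad-determined false rb rb' b≢b' 1⇾2 1⇾0 = ⊥-elim (b≢b' (trans rb (sym rb')))
right-pad-determined true () rb' b≢b' 0⇾1 0⇾2
right-pad-determined true rb () b≢b' 0⇾2 0⇾1
right-pad-determined true rb rb' b≢b' 1⇾0 1⇾2 = refl
right-pad-determined true rb rb' b≢b' 1⇾2 1⇾0 = refl

left-desubstitution : ∀ s t {m} a → Synchronizing m → Occurs (a ∷ leftPad s ++ m ++ rightPad t) →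
  ∃[ v ] hw v ≡ m × ∃[ c ] Occurs (c ∷ v) × LeftLetter s c a
left-desubstitution s t {m} a sync occ with desubstitute (a ∷ leftPad s) m (rightPad t) sync occ
... | k , W₁ , v , W₃ , eq , hv , (X , X++q≡hW₁) , _ with initLast W₁
... | [] with () ← ++-conicalʳ X (a ∷ leftPad s) X++q≡hW₁
... | W₁′ ∷ʳ′ c = v , hv , c ,
  (k , W₁′ , W₃ , trans eq (++-assoc W₁′ (c ∷ []) (v ++ W₃))) ,
  left-letter s c a X (hw W₁′) (trans X++q≡hW₁ (hw-∷ʳ W₁′ c))

right-desubstitution : ∀ s t {m} b → Synchronizing m → Occurs ((leftPad s ++ m ++ rightPad t) ∷ʳ b) →
  ∃[ v ] hw v ≡ m × ∃[ d ] Occurs (v ∷ʳ d) × RightLetter t d b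
right-desubstitution s t {m} b sync occ
  with desubstitute (leftPad s) m (rightPad t ∷ʳ b) sync (subst Occurs regroup occ)
  where
    regroup : (leftPad s ++ m ++ rightPad t) ∷ʳ b ≡ leftPad s ++ m ++ rightPad t ∷ʳ b
    regroup = trans (++-assoc (leftPad s) (m ++ rightPad t) _) (cong (leftPad s ++_) (++-assoc m (rightPad t) _))
... | k , W₁ , v , [] , _ , _ , _ , (Y , e)
  with () ← ++-conicalʳ (rightPad t) (b ∷ []) (++-conicalˡ (rightPad t ∷ʳ b) Y (sym e))
... | k , W₁ , v , d ∷ W₃ , eq , hv , _ , (Y , e) = v , hv , d ,
  (k , W₁ , W₃ , trans eq (cong (W₁ ++_) (sym (++-assoc v (d ∷ []) W₃)))) ,
  right-letter t d b W₃ Y (linked-++⁻ʳ v (linked-++⁻ʳ W₁ (subst (Linked Allowed) eq (linked-hpow k)))) e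

LeftSpecialᵒ RightSpecialᵒ Bispecialᵒ : List Letter → Set
LeftSpecialᵒ w = ∃[ a ] ∃[ a' ] a ≢ a' × Occurs (a ∷ w) × Occurs (a' ∷ w)
RightSpecialᵒ w = ∃[ b ] ∃[ b' ] b ≢ b' × Occurs (w ∷ʳ b) × Occurs (w ∷ʳ b')
Bispecialᵒ w = LeftSpecialᵒ w × RightSpecialᵒ w

padsLeft-preimage : ∀ s v {c c' a a'} → v ≢ [] → LeftLetter s c a → LeftLetter s c' a' → a ≢ a' →
                    Occurs (c ∷ v) → Occurs (c' ∷ v) → s ≡ padsLeft v
padsLeft-preimage s [] v≢[] _ _ _ _ _ = ⊥-elim (v≢[] refl)
padsLeft-preimage s (v₀ ∷ v) {c} {c'} _ la la' a≢a' oc oc' =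
  left-pad-determined s la la' a≢a' (occurs⇒allowed [] c v₀ v oc) (occurs⇒allowed [] c' v₀ v oc')

padsRight-preimage : ∀ t v {d d' b b'} → v ≢ [] → RightLetter t d b → RightLetter t d' b' → b ≢ b' →
                     Occurs (v ∷ʳ d) → Occurs (v ∷ʳ d') → t ≡ padsRight v
padsRight-preimage t [] v≢[] _ _ _ _ _ = ⊥-elim (v≢[] refl)
padsRight-preimage t (v₀ ∷ v) {d} {d'} _ rb rb' b≢b' od od' with snoc-view v₀ v
... | u , vₗ , e = trans
  (right-pad-determined t rb rb' b≢b' (last-allowed d od) (last-allowed d' od'))
  (sym (trans (cong padsRight e) (padsRight-∷ʳ u vₗ)))
  where
    last-allowed : ∀ d → Occurs ((v₀ ∷ v) ∷ʳ d) → Allowed vₗ d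
    last-allowed d o = occurs⇒allowed u vₗ d [] (subst Occurs (trans (cong (_∷ʳ d) e) (++-assoc u _ _)) o)

-- The two left (right) extensions of a padded synchronizing word come from two extensions of its
-- preimage, and they determine the pads.
bispecial-desubstitution : ∀ s t {m} → Synchronizing m → Bispecialᵒ (leftPad s ++ m ++ rightPad t) →
  ∃[ v ] v ≢ [] × Bispecialᵒ v × lift v ≡ leftPad s ++ m ++ rightPad t
bispecial-desubstitution s t {m} sync@(u , m≡u1 , _) ((a , a' , a≢a' , oa , oa') , (b , b' , b≢b' , ob , ob'))
  with left-desubstitution s t a sync oa | left-desubstitution s t a' sync oa'
     | right-desubstitution s t b sync ob | right-desubstitution s t b' sync ob'
... | v , hv , c , oc , la | v₂ , hv₂ , c' , oc' , la' | v₃ , hv₃ , d , od , rb | v₄ , hv₄ , d' , od' , rb'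
  with refl ← hw-injective {v₂} {v} (trans hv₂ (sym hv)) | refl ← hw-injective {v₃} {v} (trans hv₃ (sym hv))
     | refl ← hw-injective {v₄} {v} (trans hv₄ (sym hv)) =
  v , v≢[] , ((c , c' , c≢c' , oc , oc') , (d , d' , d≢d' , od , od')) , lift≡
  where
    v≢[] : v ≢ []
    v≢[] refl with () ← ++-conicalʳ u (l1 ∷ []) (sym (trans hv m≡u1))
    c≢c' : c ≢ c'
    c≢c' refl = a≢a' (left-letter-unique s c la la')
    d≢d' : d ≢ d'
    d≢d' refl = b≢b' (right-letter-unique t d rb rb')
    lift≡ : lift v ≡ leftPad s ++ m ++ rightPad t
    lift≡ = cong₃ (λ s′ x t′ → leftPad s′ ++ x ++ rightPad t′)
              (sym (padsLeft-preimage s v v≢[] la la' a≢a' oc oc')) hv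
              (sym (padsRight-preimage t v v≢[] rb rb' b≢b' od od'))

orbit : List Letter → ℕ → List Letter
orbit w zero = w
orbit w (suc q) = lift (orbit w q)

orbit₁ orbit₁₀ : ℕ → List Letter
orbit₁ = orbit (l1 ∷ [])
orbit₁₀ = orbit (l1 ∷ l0 ∷ [])

length-≤-hw-++ : ∀ v {r} → length v ≤ length (hw v ++ r)
length-≤-hw-++ v = ≤-trans (length-≤-hw v) (length-++-≤ˡ (hw v))

length-<-lift : ∀ a v → length (a ∷ v) < length (lift (a ∷ v))
length-<-lift zero v = s≤s (s≤s (m≤n⇒m≤1+n (length-≤-hw-++ v)))
length-<-lift (suc zero) v = s≤s (s≤s (length-≤-hw-++ v))
length-<-lift (suc (suc zero)) v = s≤s (s≤s (length-≤-hw-++ v))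

not-left-special-0 : ∀ {w} → LeftSpecialᵒ (l0 ∷ w) → ⊥
not-left-special-0 {w} (a , a' , a≢a' , oa , oa')
  with occurs⇒allowed [] a l0 w oa | occurs⇒allowed [] a' l0 w oa'
... | 1⇾0 | 1⇾0 = a≢a' refl

not-right-special-2 : ∀ {u} → RightSpecialᵒ (u ∷ʳ l2) → ⊥
not-right-special-2 {u} (b , b' , b≢b' , ob , ob')
  with occurs⇒allowed u l2 b [] (subst Occurs (++-assoc u _ _) ob)
     | occurs⇒allowed u l2 b' [] (subst Occurs (++-assoc u _ _) ob')
... | 2⇾1 | 2⇾1 = b≢b' refl

only-1⇾0 : ∀ {u z} → Linked Allowed ((u ∷ʳ z) ∷ʳ l0) → z ≡ l1
only-1⇾0 {u} {z} l with Linked.head (linked-++⁻ʳ u (subst (Linked Allowed) (++-assoc u (z ∷ []) (l0 ∷ [])) l))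
... | 1⇾0 = refl

-- Only 1 can precede 0 and only 1 can follow 2, which fixes the last letters of a right special word.
right-shape : ∀ y r → RightSpecialᵒ (y ∷ r) →
  (∃[ u ] y ∷ r ≡ u ∷ʳ l1) ⊎ (y ∷ r ≡ l0 ∷ []) ⊎ (∃[ r' ] r ≡ r' ∷ʳ l0 × ∃[ u ] y ∷ r' ≡ u ∷ʳ l1)
right-shape y r rs with snoc-view y r
... | u , suc (suc zero) , e = ⊥-elim (not-right-special-2 (subst RightSpecialᵒ e rs))
... | u , suc zero , e = inj₁ (u , e)
... | [] , zero , e = inj₂ (inj₁ e)
... | u₀ ∷ u₁ , zero , e with refl , r≡ ← ∷-injective e | snoc-view u₀ u₁
... | u' , z , e' = inj₂ (inj₂ (u₁ , r≡ , u' , trans e' (cong (u' ∷ʳ_) (only-1⇾0 linked))))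
  where
    linked : Linked Allowed ((u' ∷ʳ z) ∷ʳ l0)
    linked = subst (Linked Allowed) (trans e (cong (_∷ʳ l0) e'))
               (occurs⇒linked (occurs-prefix (y ∷ r) _ (proj₁ (proj₂ (proj₂ (proj₂ rs))))))

after-1 : ∀ {y} r → Allowed l1 y → NoLeading1 (y ∷ r)
after-1 r 1⇾0 = tt
after-1 r 1⇾2 = tt

PaddedSynchronizing : List Letter → Set
PaddedSynchronizing w = ∃[ s ] ∃[ t ] ∃[ m ] Synchronizing m × w ≡ leftPad s ++ m ++ rightPad t

bispecial-shape : ∀ x w → Bispecialᵒ (x ∷ w) →
  x ∷ w ≡ l1 ∷ [] ⊎ x ∷ w ≡ l1 ∷ l0 ∷ [] ⊎ PaddedSynchronizing (x ∷ w)
bispecial-shape zero w (ls , _) = ⊥-elim (not-left-special-0 ls)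
bispecial-shape (suc zero) [] _ = inj₁ refl
bispecial-shape (suc zero) (y ∷ r) (ls@(a , _ , _ , oa , _) , rs) with right-shape y r (suffix-right-special rs)
  where
    suffix-right-special : RightSpecialᵒ (l1 ∷ y ∷ r) → RightSpecialᵒ (y ∷ r)
    suffix-right-special (b , b' , b≢b' , ob , ob') = b , b' , b≢b' , occurs-suffix (l1 ∷ []) _ ob , occurs-suffix (l1 ∷ []) _ ob'
... | inj₁ (u , e) = inj₂ (inj₂ (true , false , y ∷ r , (u , e , after-1 r (occurs⇒allowed (a ∷ []) l1 y r oa)) ,
  cong (l1 ∷_) (sym (++-identityʳ (y ∷ r)))))
... | inj₂ (inj₁ e) = inj₂ (inj₁ (cong (l1 ∷_) e))
... | inj₂ (inj₂ (r' , r≡ , u , e)) = inj₂ (inj₂ (true , true , y ∷ r' , (u , e , after-1 r' (occurs⇒allowed (a ∷ []) l1 y r oa)) ,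
  cong (λ r → l1 ∷ y ∷ r) r≡))
bispecial-shape (suc (suc zero)) w (_ , rs) with right-shape l2 w rs
... | inj₁ (u , e) = inj₂ (inj₂ (false , false , l2 ∷ w , (u , e , tt) , sym (++-identityʳ (l2 ∷ w))))
... | inj₂ (inj₂ (r' , r≡ , u , e)) = inj₂ (inj₂ (false , true , l2 ∷ r' , (u , e , tt) , cong (l2 ∷_) r≡))

bispecial-classification : ∀ n w → length w ≤ n → w ≢ [] → Bispecialᵒ w →
  ∃[ q ] (w ≡ orbit₁ q ⊎ w ≡ orbit₁₀ q)
bispecial-classification n [] _ w≢[] _ = ⊥-elim (w≢[] refl)
bispecial-classification n (x ∷ w) w≤n _ bs with bispecial-shape x w bs
... | inj₁ e = 0 , inj₁ e
... | inj₂ (inj₁ e) = 0 , inj₂ e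
... | inj₂ (inj₂ (s , t , m , sync , e))
  with bispecial-desubstitution s t sync (subst Bispecialᵒ e bs)
... | [] , v≢[] , _ = ⊥-elim (v≢[] refl)
... | v@(a ∷ v′) , _ , bs-v , lift-v≡ with n | w≤n
... | suc n′ | s≤s w≤n′ with bispecial-classification n′ v v≤n′ (λ ()) bs-v
  where
    v≤n′ : length v ≤ n′
    v≤n′ = ≤-pred (≤-trans (length-<-lift a v′) (≤-trans (≤-reflexive (cong length (trans lift-v≡ (sym e)))) (s≤s w≤n′)))
... | q , inj₁ v≡ = suc q , inj₁ (trans e (trans (sym lift-v≡) (cong lift v≡)))
... | q , inj₂ v≡ = suc q , inj₂ (trans e (trans (sym lift-v≡) (cong lift v≡)))

-- If c precedes v and d follows v, then leftImage (padsLeft v) c precedes lift v and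
-- rightImage (padsRight v) d follows it; the values that never arise are chosen to make both maps
-- bijective.
leftImage leftImage⁻¹ rightImage rightImage⁻¹ : Bool → Letter → Letter
leftImage true zero = l0
leftImage true (suc zero) = l2
leftImage true (suc (suc zero)) = l1
leftImage false zero = l1
leftImage false (suc zero) = l2
leftImage false (suc (suc zero)) = l0
leftImage⁻¹ true zero = l0
leftImage⁻¹ true (suc zero) = l2
leftImage⁻¹ true (suc (suc zero)) = l1
leftImage⁻¹ false zero = l2
leftImage⁻¹ false (suc zero) = l0
leftImage⁻¹ false (suc (suc zero)) = l1
rightImage true zero = l1
rightImage true (suc zero) = l0
rightImage true (suc (suc zero)) = l2
rightImage false zero = l1
rightImage false (suc zero) = l2
rightImage false (suc (suc zero)) = l0
rightImage⁻¹ true zero = l1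
rightImage⁻¹ true (suc zero) = l0
rightImage⁻¹ true (suc (suc zero)) = l2
rightImage⁻¹ false zero = l2
rightImage⁻¹ false (suc zero) = l0
rightImage⁻¹ false (suc (suc zero)) = l1

leftImage-injective : ∀ s {x y} → leftImage s x ≡ leftImage s y → x ≡ y
leftImage-injective s = retraction⇒injective (leftImage s) (leftImage⁻¹ s) (retract s)
  where
    retract : ∀ s x → leftImage⁻¹ s (leftImage s x) ≡ x
    retract true zero = refl
    retract true (suc zero) = refl
    retract true (suc (suc zero)) = refl
    retract false zero = refl
    retract false (suc zero) = refl
    retract false (suc (suc zero)) = refl

rightImage-injective : ∀ t {x y} → rightImage t x ≡ rightImage t y → x ≡ y
rightImage-injective t = retraction⇒injective (rightImage t) (rightImage⁻¹ t) (retract t)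
  where
    retract : ∀ t x → rightImage⁻¹ t (rightImage t x) ≡ x
    retract true zero = refl
    retract true (suc zero) = refl
    retract true (suc (suc zero)) = refl
    retract false zero = refl
    retract false (suc zero) = refl
    retract false (suc (suc zero)) = refl

h-ends-with-leftImage : ∀ {c v₀} → Allowed c v₀ → ∃[ α ] h c ≡ α ++ leftImage (notOne v₀) c ∷ leftPad (notOne v₀)
h-ends-with-leftImage 0⇾1 = l0 ∷ [] , refl
h-ends-with-leftImage 0⇾2 = [] , refl
h-ends-with-leftImage 1⇾0 = [] , refl
h-ends-with-leftImage 1⇾2 = [] , refl
h-ends-with-leftImage 2⇾1 = [] , refl

h-starts-with-rightImage : ∀ {vₗ d e} → Allowed vₗ d → Allowed d e →
  ∃[ γ ] h d ++ h e ≡ rightPad (isOne vₗ) ++ rightImage (isOne vₗ) d ∷ γ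
h-starts-with-rightImage {e = e} 0⇾1 _ = l1 ∷ h e , refl
h-starts-with-rightImage {e = e} 0⇾2 _ = h e , refl
h-starts-with-rightImage {e = e} 1⇾0 _ = h e , refl
h-starts-with-rightImage 1⇾2 2⇾1 = l1 ∷ [] , refl
h-starts-with-rightImage {e = e} 2⇾1 _ = l1 ∷ h e , refl

lift-occurrence : ∀ v₀ v₁ {c d e} → Occurs (c ∷ ((v₀ ∷ v₁) ∷ʳ d) ∷ʳ e) →
  Occurs (leftImage (padsLeft (v₀ ∷ v₁)) c ∷ (lift (v₀ ∷ v₁) ∷ʳ rightImage (padsRight (v₀ ∷ v₁)) d))
lift-occurrence v₀ v₁ {c} {d} {e} occ with snoc-view v₀ v₁
... | u , vₗ , v≡u∷ʳvₗ with h-ends-with-leftImage c⇾v₀ | h-starts-with-rightImage vₗ⇾d d⇾e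
  where
    v : List Letter
    v = v₀ ∷ v₁
    c⇾v₀ : Allowed c v₀
    c⇾v₀ = occurs⇒allowed [] c v₀ _ occ
    vₗ⇾d : Allowed vₗ d
    vₗ⇾d = occurs⇒allowed (c ∷ u) vₗ d (e ∷ []) (subst Occurs (cong (c ∷_) (begin
      (v ∷ʳ d) ∷ʳ e           ≡⟨ cong (λ x → (x ∷ʳ d) ∷ʳ e) v≡u∷ʳvₗ ⟩
      ((u ∷ʳ vₗ) ∷ʳ d) ∷ʳ e   ≡⟨ ++-assoc (u ∷ʳ vₗ) (d ∷ []) (e ∷ []) ⟩
      (u ∷ʳ vₗ) ++ d ∷ e ∷ [] ≡⟨ ++-assoc u (vₗ ∷ []) (d ∷ e ∷ []) ⟩
      u ++ vₗ ∷ d ∷ e ∷ []    ∎)) occ)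
      where open ≡-Reasoning
    d⇾e : Allowed d e
    d⇾e = occurs⇒allowed (c ∷ v) d e [] (subst Occurs (cong (c ∷_) (++-assoc v (d ∷ []) (e ∷ []))) occ)
... | α , hc≡ | γ , hde≡ = occurs-infix α _ γ (subst Occurs image≡ (occurs-hw occ))
  where
    open ≡-Reasoning
    v : List Letter
    v = v₀ ∷ v₁
    s : Bool
    s = notOne v₀
    t : Bool
    t = isOne vₗ
    G : Letter
    G = leftImage s c
    H : Letter
    H = rightImage t d
    image≡ : hw (c ∷ (v ∷ʳ d) ∷ʳ e) ≡ α ++ (G ∷ (lift v ∷ʳ rightImage (padsRight v) d)) ++ γ
    image≡ = begin
      hw (c ∷ (v ∷ʳ d) ∷ʳ e)                                   ≡⟨ cong (h c ++_) (hw-∷ʳ (v ∷ʳ d) e) ⟩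
      h c ++ hw (v ∷ʳ d) ++ h e                                ≡⟨ cong (λ x → h c ++ x ++ h e) (hw-∷ʳ v d) ⟩
      h c ++ (hw v ++ h d) ++ h e                              ≡⟨ cong (h c ++_) (++-assoc (hw v) (h d) (h e)) ⟩
      h c ++ hw v ++ h d ++ h e                                ≡⟨ cong₂ (λ x y → x ++ hw v ++ y) hc≡ hde≡ ⟩
      (α ++ G ∷ leftPad s) ++ hw v ++ rightPad t ++ H ∷ γ      ≡⟨ regroup α G (leftPad s) (hw v) (rightPad t) H γ ⟩
      α ++ (G ∷ ((leftPad s ++ hw v ++ rightPad t) ∷ʳ H)) ++ γ ≡⟨ cong (λ t′ → α ++ (G ∷ ((leftPad s ++ hw v ++ rightPad t′) ∷ʳ rightImage t′ d)) ++ γ)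
                                                                    (sym (trans (cong padsRight v≡u∷ʳvₗ) (padsRight-∷ʳ u vₗ))) ⟩
      α ++ (G ∷ (lift v ∷ʳ rightImage (padsRight v) d)) ++ γ  ∎
      where
        regroup : ∀ (α : List Letter) g l m r x γ →
                  (α ++ g ∷ l) ++ m ++ r ++ x ∷ γ ≡ α ++ (g ∷ ((l ++ m ++ r) ∷ʳ x)) ++ γ
        regroup [] g l m r x γ = cong (g ∷_) (sym (begin
          ((l ++ m ++ r) ∷ʳ x) ++ γ  ≡⟨ ++-assoc (l ++ m ++ r) (x ∷ []) γ ⟩
          (l ++ m ++ r) ++ x ∷ γ     ≡⟨ ++-assoc l (m ++ r) (x ∷ γ) ⟩
          l ++ (m ++ r) ++ x ∷ γ     ≡⟨ cong (l ++_) (++-assoc m r (x ∷ γ)) ⟩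
          l ++ m ++ r ++ x ∷ γ       ∎))
        regroup (a ∷ α) g l m r x γ = cong (a ∷_) (regroup α g l m r x γ)

lift-bispecial : ∀ v → v ≢ [] → Bispecialᵒ v → Bispecialᵒ (lift v)
lift-bispecial [] v≢[] _ = ⊥-elim (v≢[] refl)
lift-bispecial v@(v₀ ∷ v₁) _ ((c , c' , c≢c' , oc , oc') , (d , d' , d≢d' , od , od')) =
  (G c , G c' , c≢c' ∘ leftImage-injective (padsLeft v) , left oc , left oc') ,
  (H d , H d' , d≢d' ∘ rightImage-injective (padsRight v) , right od , right od')
  where
    G : Letter → Letter
    G = leftImage (padsLeft v)
    H : Letter → Letter
    H = rightImage (padsRight v)
    left : ∀ {c} → Occurs (c ∷ v) → Occurs (G c ∷ lift v)
    left {c} o with occurs-extendʳ o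
    ... | d , o₁ with occurs-extendʳ o₁
    ... | e , o₂ = occurs-prefix (G c ∷ lift v) _ (lift-occurrence v₀ v₁ o₂)
    right : ∀ {d} → Occurs (v ∷ʳ d) → Occurs (lift v ∷ʳ H d)
    right {d} o with occurs-extendʳ o
    ... | e , o₁ with occurs-extendˡ o₁
    ... | c , o₂ = occurs-suffix (G c ∷ []) _ (lift-occurrence v₀ v₁ o₂)

-- Greedy representations

value : List Bool → ℕ
value [] = 0
value (true ∷ w) = X (suc (length w)) + value w
value (false ∷ w) = value w

X-< : ∀ n → X n < X (suc n)
X-< zero = s≤s z≤n
X-< (suc zero) = s≤s (s≤s z≤n)
X-< (suc (suc zero)) = s≤s (s≤s (s≤s z≤n))
X-< (suc (suc (suc zero))) = s≤s (s≤s (s≤s (s≤s (s≤s z≤n))))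
X-< (suc (suc (suc (suc m)))) =
  ≤-<-trans (m≤m+n (X (4 + m)) (X (3 + m))) (m<m+n _ (≤-<-trans z≤n (X-< m)))

X-mono-≤ : ∀ {m n} → m ≤ n → X m ≤ X n
X-mono-≤ {m} {n} m≤n with m≤n⇒m<n∨m≡n m≤n
... | inj₂ refl = ≤-refl
... | inj₁ (s≤s {n = n′} m≤n′) = ≤-trans (X-mono-≤ m≤n′) (<⇒≤ (X-< n′))

n≤X : ∀ n → n ≤ X n
n≤X zero = z≤n
n≤X (suc n) = ≤-trans (s≤s (n≤X n)) (X-< n)

X-≤-double : ∀ n → X (suc (suc n)) ≤ X (suc n) + X (suc n)
X-≤-double zero = s≤s (s≤s z≤n)
X-≤-double (suc zero) = s≤s (s≤s (s≤s (s≤s z≤n)))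
X-≤-double (suc (suc zero)) = s≤s (s≤s (s≤s (s≤s (s≤s (s≤s (s≤s z≤n))))))
X-≤-double (suc (suc (suc m))) = subst (_≤ X (4 + m) + X (4 + m)) (sym (+-assoc (X (4 + m)) (X (3 + m)) (X (1 + m))))
  (+-monoʳ-≤ (X (4 + m)) (X-skip m))
  where
    X-skip : ∀ m → X (3 + m) + X (1 + m) ≤ X (4 + m)
    X-skip zero = s≤s (s≤s (s≤s (s≤s (s≤s z≤n))))
    X-skip (suc m) = subst (X (4 + m) + X (2 + m) ≤_) (sym (+-assoc (X (4 + m)) (X (3 + m)) (X (1 + m))))
      (+-monoʳ-≤ (X (4 + m)) (≤-trans (<⇒≤ (X-< (2 + m))) (m≤m+n _ _)))

X-≥-fibonacci : ∀ m → X (2 + m) + X (1 + m) ≤ X (3 + m)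
X-≥-fibonacci zero = s≤s (s≤s (s≤s z≤n))
X-≥-fibonacci (suc zero) = s≤s (s≤s (s≤s (s≤s (s≤s (s≤s z≤n)))))
X-≥-fibonacci (suc (suc m)) = m≤m+n _ _

-- Digit strings, most significant digit first, avoiding the factors 111 and 1101.
data Admissible : List Bool → Set where
  []      : Admissible []
  0∷_     : ∀ {w} → Admissible w → Admissible (false ∷ w)
  1∷[]    : Admissible (true ∷ [])
  10∷_    : ∀ {w} → Admissible w → Admissible (true ∷ false ∷ w)
  11∷[]   : Admissible (true ∷ true ∷ [])
  110∷[]  : Admissible (true ∷ true ∷ false ∷ [])
  1100∷_  : ∀ {w} → Admissible w → Admissible (true ∷ true ∷ false ∷ false ∷ w)

admissible-tail : ∀ {b w} → Admissible (b ∷ w) → Admissible w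
admissible-tail (0∷ a) = a
admissible-tail 1∷[] = []
admissible-tail (10∷ a) = 0∷ a
admissible-tail 11∷[] = 1∷[]
admissible-tail 110∷[] = 10∷ []
admissible-tail (1100∷ a) = 10∷ (0∷ a)

value<X : ∀ {s} → Admissible s → value s < X (suc (length s))
value<X [] = s≤s z≤n
value<X (0∷_ {w} a) = <-≤-trans (value<X a) (<⇒≤ (X-< (suc (length w))))
value<X 1∷[] = s≤s (s≤s z≤n)
value<X (10∷_ {w} a) = <-≤-trans (+-monoʳ-< (X (2 + length w)) (value<X a)) (X-≥-fibonacci (length w))
value<X 11∷[] = s≤s (s≤s (s≤s (s≤s z≤n)))
value<X 110∷[] = s≤s (s≤s (s≤s (s≤s (s≤s (s≤s (s≤s z≤n))))))
value<X (1100∷_ {w} a) = subst (X (4 + length w) + (X (3 + length w) + value w) <_)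
   (sym (+-assoc (X (4 + length w)) (X (3 + length w)) (X (1 + length w))))
   (+-monoʳ-< (X (4 + length w)) (+-monoʳ-< (X (3 + length w)) (value<X a)))

length-greedyDigits : ∀ k r → length (greedyDigits k r) ≡ k
length-greedyDigits zero r = refl
length-greedyDigits (suc k) r with X (suc k) ≤ᵇ r
... | true = cong suc (length-greedyDigits k _)
... | false = cong suc (length-greedyDigits k _)

value-greedyDigits : ∀ k r → r < X (suc k) → value (greedyDigits k r) ≡ r
value-greedyDigits zero zero _ = refl
value-greedyDigits zero (suc r) (s≤s ())
value-greedyDigits (suc k) r r<X with X (suc k) ≤ᵇ r in eq
... | true = begin
  X (suc (length (greedyDigits k (r ∸ X (suc k))))) + value (greedyDigits k (r ∸ X (suc k)))
    ≡⟨ cong₂ (λ n m → X (suc n) + m) (length-greedyDigits k _) (value-greedyDigits k (r ∸ X (suc k)) rest<X) ⟩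
  X (suc k) + (r ∸ X (suc k))
    ≡⟨ m+[n∸m]≡n X≤r ⟩
  r ∎
  where
    open ≡-Reasoning
    X≤r : X (suc k) ≤ r
    X≤r = ≤ᵇ⇒≤ (X (suc k)) r (subst T (sym eq) tt)
    rest<X : r ∸ X (suc k) < X (suc k)
    rest<X = +-cancelˡ-< (X (suc k)) _ _
               (subst (_< X (suc k) + X (suc k)) (sym (m+[n∸m]≡n X≤r)) (<-≤-trans r<X (X-≤-double k)))
... | false = value-greedyDigits k r (≰⇒> (λ X≤r → subst T eq (≤⇒≤ᵇ X≤r)))

value-dropLeadingZeros : ∀ s → value (dropLeadingZeros s) ≡ value s
value-dropLeadingZeros [] = refl
value-dropLeadingZeros (false ∷ s) = value-dropLeadingZeros s
value-dropLeadingZeros (true ∷ s) = refl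

value-repP : ∀ N → value (repP N) ≡ N
value-repP N = trans (value-dropLeadingZeros (greedyDigits N N)) (value-greedyDigits N N (≤-<-trans (n≤X N) (X-< N)))

dropLeadingZeros-replicate : ∀ n s → dropLeadingZeros (replicate n false ++ s) ≡ dropLeadingZeros s
dropLeadingZeros-replicate zero s = refl
dropLeadingZeros-replicate (suc n) s = dropLeadingZeros-replicate n s

-- The greedy algorithm reproduces every admissible string (uniqueness of the representation).
greedyDigits-value : ∀ k s → Admissible s → length s ≤ k →
                     greedyDigits k (value s) ≡ replicate (k ∸ length s) false ++ s
greedyDigits-value-short : ∀ k s → Admissible s → length s ≤ k →
                           greedyDigits (suc k) (value s) ≡ replicate (suc k ∸ length s) false ++ s
greedyDigits-value-full : ∀ s → Admissible s → greedyDigits (length s) (value s) ≡ s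

greedyDigits-value zero [] _ _ = refl
greedyDigits-value (suc k) s a s≤1+k with m≤n⇒m<n∨m≡n s≤1+k
... | inj₁ (s≤s s≤k) = greedyDigits-value-short k s a s≤k
... | inj₂ s≡1+k = trans (subst (λ n → greedyDigits n (value s) ≡ s) s≡1+k (greedyDigits-value-full s a))
                         (cong (λ n → replicate n false ++ s) (sym (trans (cong (_∸ length s) (sym s≡1+k)) (n∸n≡0 (length s)))))

greedyDigits-value-short k s a s≤k with X (suc k) ≤ᵇ value s in eq
... | true = ⊥-elim (<⇒≱ (<-≤-trans (value<X a) (X-mono-≤ (s≤s s≤k))) (≤ᵇ⇒≤ _ _ (subst T (sym eq) tt)))
... | false = trans (cong (false ∷_) (greedyDigits-value k s a s≤k))
                    (cong (λ n → replicate n false ++ s) (sym (+-∸-assoc 1 s≤k)))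

greedyDigits-value-full [] _ = refl
greedyDigits-value-full (true ∷ s) a with X (suc (length s)) ≤ᵇ (X (suc (length s)) + value s) in eq
... | false = ⊥-elim (subst T eq (≤⇒≤ᵇ (m≤m+n (X (suc (length s))) (value s))))
... | true rewrite m+n∸m≡n (X (suc (length s))) (value s) =
  cong (true ∷_) (rest-is-s (greedyDigits-value (length s) s (admissible-tail a) ≤-refl))
  where
    rest-is-s : ∀ {x} → x ≡ replicate (length s ∸ length s) false ++ s → x ≡ s
    rest-is-s e = trans e (cong (λ n → replicate n false ++ s) (n∸n≡0 (length s)))
greedyDigits-value-full (false ∷ s) a with X (suc (length s)) ≤ᵇ value s in eq
... | true = ⊥-elim (<⇒≱ (value<X (admissible-tail a)) (≤ᵇ⇒≤ _ _ (subst T (sym eq) tt)))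
... | false = cong (false ∷_) (trans (greedyDigits-value (length s) s (admissible-tail a) ≤-refl)
                                     (cong (λ n → replicate n false ++ s) (n∸n≡0 (length s))))

repP-value : ∀ s → Admissible s → 0 < value s → repP (value s) ≡ dropLeadingZeros s
repP-value [] _ ()
repP-value (false ∷ s) (0∷ a) pos = repP-value s a pos
repP-value (true ∷ s) a _ = trans (cong dropLeadingZeros (greedyDigits-value N (true ∷ s) a s≤N))
                                  (dropLeadingZeros-replicate (N ∸ length (true ∷ s)) (true ∷ s))
  where
    N : ℕ
    N = value (true ∷ s)
    s≤N : length (true ∷ s) ≤ N
    s≤N = ≤-trans (n≤X (suc (length s))) (m≤m+n _ _)

-- The representations of the lengths of orbit₁ q and orbit₁₀ q, padded with zeros to length q + 2.
digits₁ digits₁₀ : ℕ → List Bool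
digits₁ 0 = false ∷ true ∷ []
digits₁ 1 = false ∷ true ∷ true ∷ []
digits₁ 2 = false ∷ true ∷ true ∷ false ∷ []
digits₁ 3 = true ∷ false ∷ false ∷ false ∷ false ∷ []
digits₁ (suc (suc (suc (suc q)))) = true ∷ false ∷ false ∷ false ∷ digits₁ q
digits₁₀ 0 = true ∷ false ∷ []
digits₁₀ 1 = true ∷ false ∷ false ∷ []
digits₁₀ 2 = true ∷ false ∷ true ∷ false ∷ []
digits₁₀ 3 = true ∷ false ∷ true ∷ false ∷ false ∷ []
digits₁₀ (suc (suc (suc (suc q)))) = true ∷ false ∷ true ∷ false ∷ digits₁₀ q

length-digits₁ : ∀ q → length (digits₁ q) ≡ 2 + q
length-digits₁ 0 = refl
length-digits₁ 1 = refl
length-digits₁ 2 = refl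
length-digits₁ 3 = refl
length-digits₁ (suc (suc (suc (suc q)))) = cong (4 +_) (length-digits₁ q)

length-digits₁₀ : ∀ q → length (digits₁₀ q) ≡ 2 + q
length-digits₁₀ 0 = refl
length-digits₁₀ 1 = refl
length-digits₁₀ 2 = refl
length-digits₁₀ 3 = refl
length-digits₁₀ (suc (suc (suc (suc q)))) = cong (4 +_) (length-digits₁₀ q)

N₁ N₁₀ : ℕ → ℕ
N₁ q = value (digits₁ q)
N₁₀ q = value (digits₁₀ q)

N₁-+4 : ∀ q → N₁ (4 + q) ≡ X (6 + q) + N₁ q
N₁-+4 q = cong (λ n → X (4 + n) + N₁ q) (length-digits₁ q)

N₁₀-+4 : ∀ q → N₁₀ (4 + q) ≡ X (6 + q) + (X (4 + q) + N₁₀ q)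
N₁₀-+4 q = cong (λ n → X (4 + n) + (X (2 + n) + N₁₀ q)) (length-digits₁₀ q)

parity : ℕ → ℕ
parity 0 = 0
parity 1 = 1
parity (suc (suc q)) = parity q

parity-+1 : ∀ q → parity q + parity (suc q) ≡ 1
parity-+1 zero = refl
parity-+1 (suc zero) = refl
parity-+1 (suc (suc q)) = parity-+1 q

X-identity : ∀ m → X (4 + m) + X (2 + m) ≡ 2 * X (3 + m) + X (1 + m)
X-identity 0 = refl
X-identity 1 = refl
X-identity 2 = refl
X-identity 3 = refl
X-identity (suc (suc (suc (suc m)))) =
  combine (X (1 + m)) (X (2 + m)) (X (3 + m)) (X (4 + m)) (X (5 + m)) (X (6 + m)) (X (7 + m))
          (X-identity (suc (suc (suc m)))) (X-identity (suc (suc m))) (X-identity m)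
  where
    combine : ∀ x₁ x₂ x₃ x₄ x₅ x₆ x₇ → x₇ + x₅ ≡ 2 * x₆ + x₄ → x₆ + x₄ ≡ 2 * x₅ + x₃ → x₄ + x₂ ≡ 2 * x₃ + x₁ →
              (x₇ + x₆ + x₄) + (x₅ + x₄ + x₂) ≡ 2 * (x₆ + x₅ + x₃) + (x₄ + x₃ + x₁)
    combine x₁ x₂ x₃ x₄ x₅ x₆ x₇ e₇ e₆ e₄ =
      trans (regroup x₂ x₄ x₅ x₆ x₇) (trans (cong₃ (λ a b c → a + b + c) e₇ e₆ e₄) (collect x₁ x₃ x₄ x₅ x₆))
      where
        regroup : ∀ x₂ x₄ x₅ x₆ x₇ → (x₇ + x₆ + x₄) + (x₅ + x₄ + x₂) ≡ (x₇ + x₅) + (x₆ + x₄) + (x₄ + x₂)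
        regroup = solve-∀
        collect : ∀ x₁ x₃ x₄ x₅ x₆ → (2 * x₆ + x₄) + (2 * x₅ + x₃) + (2 * x₃ + x₁) ≡ 2 * (x₆ + x₅ + x₃) + (x₄ + x₃ + x₁)
        collect = solve-∀

N₁₀-suc : ∀ q → N₁₀ (suc q) ≡ N₁₀ q + N₁ q + 1 + parity q
N₁₀-suc 0 = refl
N₁₀-suc 1 = refl
N₁₀-suc 2 = refl
N₁₀-suc 3 = refl
N₁₀-suc (suc (suc (suc (suc q)))) = begin
  N₁₀ (5 + q)                                               ≡⟨ N₁₀-+4 (suc q) ⟩
  X (7 + q) + (X (5 + q) + N₁₀ (suc q))                     ≡⟨ cong (λ n → X (7 + q) + (X (5 + q) + n)) (N₁₀-suc q) ⟩
  X (7 + q) + (X (5 + q) + (N₁₀ q + N₁ q + 1 + parity q))   ≡⟨ regroup (X (7 + q)) (X (5 + q)) (N₁₀ q) (N₁ q) (parity q) ⟩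
  (X (7 + q) + X (5 + q)) + (N₁₀ q + N₁ q + 1 + parity q)   ≡⟨ cong (_+ (N₁₀ q + N₁ q + 1 + parity q)) (X-identity (3 + q)) ⟩
  (2 * X (6 + q) + X (4 + q)) + (N₁₀ q + N₁ q + 1 + parity q) ≡⟨ distribute (X (6 + q)) (X (4 + q)) (N₁₀ q) (N₁ q) (parity q) ⟩
  (X (6 + q) + (X (4 + q) + N₁₀ q)) + (X (6 + q) + N₁ q) + 1 + parity q
    ≡⟨ cong₂ (λ a b → a + b + 1 + parity q) (N₁₀-+4 q) (N₁-+4 q) ⟨
  N₁₀ (4 + q) + N₁ (4 + q) + 1 + parity q                   ∎
  where
    open ≡-Reasoning
    regroup : ∀ a b vo ve p → a + (b + (vo + ve + 1 + p)) ≡ (a + b) + (vo + ve + 1 + p)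
    regroup = solve-∀
    distribute : ∀ c d vo ve p → (2 * c + d) + (vo + ve + 1 + p) ≡ (c + (d + vo)) + (c + ve) + 1 + p
    distribute = solve-∀

N₁-suc-suc : ∀ q → N₁ (2 + q) ≡ N₁ (suc q) + N₁₀ q + 1 + parity q
N₁-suc-suc 0 = refl
N₁-suc-suc 1 = refl
N₁-suc-suc 2 = refl
N₁-suc-suc 3 = refl
N₁-suc-suc (suc (suc (suc (suc q)))) = begin
  N₁ (6 + q)                                                     ≡⟨ N₁-+4 (2 + q) ⟩
  X (8 + q) + N₁ (2 + q)                                         ≡⟨ cong (X (8 + q) +_) (N₁-suc-suc q) ⟩
  (X (7 + q) + X (6 + q) + X (4 + q)) + (N₁ (suc q) + N₁₀ q + 1 + parity q)
    ≡⟨ regroup (X (7 + q)) (X (6 + q)) (X (4 + q)) (N₁ (suc q)) (N₁₀ q) (parity q) ⟩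
  (X (7 + q) + N₁ (suc q)) + (X (6 + q) + (X (4 + q) + N₁₀ q)) + 1 + parity q
    ≡⟨ cong₂ (λ a b → a + b + 1 + parity q) (N₁-+4 (1 + q)) (N₁₀-+4 q) ⟨
  N₁ (5 + q) + N₁₀ (4 + q) + 1 + parity q                        ∎
  where
    open ≡-Reasoning
    regroup : ∀ a b c ve vo p → (a + b + c) + (ve + vo + 1 + p) ≡ (a + ve) + (b + (c + vo)) + 1 + p
    regroup = solve-∀

admissible-digits₁ : ∀ q → Admissible (digits₁ q)
admissible-digits₁ 0 = 0∷ 1∷[]
admissible-digits₁ 1 = 0∷ 11∷[]
admissible-digits₁ 2 = 0∷ 110∷[]
admissible-digits₁ 3 = 10∷ 0∷ 0∷ 0∷ []
admissible-digits₁ (suc (suc (suc (suc q)))) = 10∷ 0∷ 0∷ admissible-digits₁ q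

admissible-digits₁₀ : ∀ q → Admissible (digits₁₀ q)
admissible-digits₁₀ 0 = 10∷ []
admissible-digits₁₀ 1 = 10∷ 0∷ []
admissible-digits₁₀ 2 = 10∷ 10∷ []
admissible-digits₁₀ 3 = 10∷ 10∷ 0∷ []
admissible-digits₁₀ (suc (suc (suc (suc q)))) = 10∷ 10∷ admissible-digits₁₀ q

N₁-pos : ∀ q → 0 < N₁ q
N₁-pos 0 = s≤s z≤n
N₁-pos 1 = s≤s z≤n
N₁-pos 2 = s≤s z≤n
N₁-pos 3 = s≤s z≤n
N₁-pos (suc (suc (suc (suc q)))) = ≤-trans (N₁-pos q) (m≤n+m _ _)

N₁₀-pos : ∀ q → 0 < N₁₀ q
N₁₀-pos 0 = s≤s z≤n
N₁₀-pos 1 = s≤s z≤n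
N₁₀-pos 2 = s≤s z≤n
N₁₀-pos 3 = s≤s z≤n
N₁₀-pos (suc (suc (suc (suc q)))) = ≤-trans (N₁₀-pos q) (≤-trans (m≤n+m (N₁₀ q) (X (2 + length (digits₁₀ q)))) (m≤n+m _ (X (4 + length (digits₁₀ q)))))

ThousandPlus-digits₁ : ∀ q → ThouPlus (digits₁ (3 + q))
ThousandPlus-digits₁ 0 = base s0
ThousandPlus-digits₁ 1 = base s01
ThousandPlus-digits₁ 2 = base s011
ThousandPlus-digits₁ 3 = base s0110
ThousandPlus-digits₁ (suc (suc (suc (suc q)))) = step (ThousandPlus-digits₁ q)

TenPlus-digits₁₀ : ∀ q → TenPlus (digits₁₀ q)
TenPlus-digits₁₀ 0 = base eps
TenPlus-digits₁₀ 1 = base zer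
TenPlus-digits₁₀ 2 = step (base eps)
TenPlus-digits₁₀ 3 = step (base zer)
TenPlus-digits₁₀ (suc (suc (suc (suc q)))) = step (step (TenPlus-digits₁₀ q))

dropLeadingZeros-digits₁₀ : ∀ q → dropLeadingZeros (digits₁₀ q) ≡ digits₁₀ q
dropLeadingZeros-digits₁₀ 0 = refl
dropLeadingZeros-digits₁₀ 1 = refl
dropLeadingZeros-digits₁₀ 2 = refl
dropLeadingZeros-digits₁₀ 3 = refl
dropLeadingZeros-digits₁₀ (suc (suc (suc (suc q)))) = refl

dropLeadingZeros-digits₁ : ∀ q → dropLeadingZeros (digits₁ (3 + q)) ≡ digits₁ (3 + q)
dropLeadingZeros-digits₁ 0 = refl
dropLeadingZeros-digits₁ (suc q) = refl

InL-digits₁ : ∀ q → InL (dropLeadingZeros (digits₁ q))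
InL-digits₁ 0 = w1
InL-digits₁ 1 = w11
InL-digits₁ 2 = w110
InL-digits₁ (suc (suc (suc q))) = subst InL (sym (dropLeadingZeros-digits₁ q)) (thou (ThousandPlus-digits₁ q))

InL-digits₁₀ : ∀ q → InL (dropLeadingZeros (digits₁₀ q))
InL-digits₁₀ q = subst InL (sym (dropLeadingZeros-digits₁₀ q)) (ten (TenPlus-digits₁₀ q))

InL-inversion : ∀ {t} → InL t → ∃[ q ] (t ≡ dropLeadingZeros (digits₁ q) ⊎ t ≡ dropLeadingZeros (digits₁₀ q))
InL-inversion w1 = 0 , inj₁ refl
InL-inversion w11 = 1 , inj₁ refl
InL-inversion w110 = 2 , inj₁ refl
InL-inversion (ten p) with ten-inversion p
  where
    digits₁₀-+2 : ∀ q → digits₁₀ (2 + q) ≡ true ∷ false ∷ digits₁₀ q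
    digits₁₀-+2 0 = refl
    digits₁₀-+2 1 = refl
    digits₁₀-+2 2 = refl
    digits₁₀-+2 3 = refl
    digits₁₀-+2 (suc (suc (suc (suc q)))) = cong (λ r → true ∷ false ∷ true ∷ false ∷ r) (digits₁₀-+2 q)
    ten-inversion : ∀ {t} → TenPlus t → ∃[ q ] t ≡ digits₁₀ q
    ten-inversion (base eps) = 0 , refl
    ten-inversion (base zer) = 1 , refl
    ten-inversion (step p) with ten-inversion p
    ... | q , e = 2 + q , trans (cong (λ r → true ∷ false ∷ r) e) (sym (digits₁₀-+2 q))
... | q , e = q , inj₂ (trans e (sym (dropLeadingZeros-digits₁₀ q)))
InL-inversion (thou p) with thousand-inversion p
  where
    thousand-inversion : ∀ {t} → ThouPlus t → ∃[ q ] t ≡ digits₁ (3 + q)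
    thousand-inversion (base s0) = 0 , refl
    thousand-inversion (base s01) = 1 , refl
    thousand-inversion (base s011) = 2 , refl
    thousand-inversion (base s0110) = 3 , refl
    thousand-inversion (step p) with thousand-inversion p
    ... | q , e = 4 + q , cong (λ r → true ∷ false ∷ false ∷ false ∷ r) e
... | q , e = 3 + q , inj₁ (trans e (sym (dropLeadingZeros-digits₁ q)))

-- Lengths of the bispecial factors

count₀ count₁ count₂ : List Letter → ℕ
count₀ [] = 0
count₀ (zero ∷ w) = suc (count₀ w)
count₀ (suc _ ∷ w) = count₀ w
count₁ [] = 0
count₁ (suc zero ∷ w) = suc (count₁ w)
count₁ (zero ∷ w) = count₁ w
count₁ (suc (suc _) ∷ w) = count₁ w
count₂ [] = 0
count₂ (suc (suc zero) ∷ w) = suc (count₂ w)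
count₂ (zero ∷ w) = count₂ w
count₂ (suc zero ∷ w) = count₂ w

count₀-++ : ∀ x y → count₀ (x ++ y) ≡ count₀ x + count₀ y
count₀-++ [] y = refl
count₀-++ (zero ∷ x) y = cong suc (count₀-++ x y)
count₀-++ (suc zero ∷ x) y = count₀-++ x y
count₀-++ (suc (suc zero) ∷ x) y = count₀-++ x y

count₁-++ : ∀ x y → count₁ (x ++ y) ≡ count₁ x + count₁ y
count₁-++ [] y = refl
count₁-++ (zero ∷ x) y = count₁-++ x y
count₁-++ (suc zero ∷ x) y = cong suc (count₁-++ x y)
count₁-++ (suc (suc zero) ∷ x) y = count₁-++ x y

count₂-++ : ∀ x y → count₂ (x ++ y) ≡ count₂ x + count₂ y
count₂-++ [] y = refl
count₂-++ (zero ∷ x) y = count₂-++ x y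
count₂-++ (suc zero ∷ x) y = count₂-++ x y
count₂-++ (suc (suc zero) ∷ x) y = cong suc (count₂-++ x y)

count₀-hw : ∀ v → count₀ (hw v) ≡ count₀ v + count₂ v
count₀-hw [] = refl
count₀-hw (zero ∷ v) = cong suc (count₀-hw v)
count₀-hw (suc zero ∷ v) = count₀-hw v
count₀-hw (suc (suc zero) ∷ v) = trans (cong suc (count₀-hw v)) (sym (+-suc (count₀ v) (count₂ v)))

count₁-hw : ∀ v → count₁ (hw v) ≡ count₀ v + count₁ v
count₁-hw [] = refl
count₁-hw (zero ∷ v) = cong suc (count₁-hw v)
count₁-hw (suc zero ∷ v) = trans (cong suc (count₁-hw v)) (sym (+-suc (count₀ v) (count₁ v)))
count₁-hw (suc (suc zero) ∷ v) = count₁-hw v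

count₂-hw : ∀ v → count₂ (hw v) ≡ count₁ v
count₂-hw [] = refl
count₂-hw (zero ∷ v) = count₂-hw v
count₂-hw (suc zero ∷ v) = cong suc (count₂-hw v)
count₂-hw (suc (suc zero) ∷ v) = count₂-hw v

length≡counts : ∀ w → length w ≡ count₀ w + count₁ w + count₂ w
length≡counts [] = refl
length≡counts (zero ∷ w) = cong suc (length≡counts w)
length≡counts (suc zero ∷ w) = trans (cong suc (length≡counts w)) (cong (_+ count₂ w) (sym (+-suc (count₀ w) (count₁ w))))
length≡counts (suc (suc zero) ∷ w) = trans (cong suc (length≡counts w)) (sym (+-suc (count₀ w + count₁ w) (count₂ w)))

bit : Bool → ℕ
bit true = 1
bit false = 0

count₀-lift : ∀ v → count₀ (lift v) ≡ count₀ v + count₂ v + bit (padsRight v)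
count₀-lift v = begin
  count₀ (leftPad s ++ hw v ++ rightPad t)                 ≡⟨ count₀-++ (leftPad s) _ ⟩
  count₀ (leftPad s) + count₀ (hw v ++ rightPad t)         ≡⟨ cong (count₀ (leftPad s) +_) (count₀-++ (hw v) (rightPad t)) ⟩
  count₀ (leftPad s) + (count₀ (hw v) + count₀ (rightPad t)) ≡⟨ cong₃ (λ a b c → a + (b + c)) (pad₀ s) (count₀-hw v) (pad₁ t) ⟩
  count₀ v + count₂ v + bit t                              ∎
  where
    open ≡-Reasoning
    s : Bool
    s = padsLeft v
    t : Bool
    t = padsRight v
    pad₀ : ∀ s → count₀ (leftPad s) ≡ 0
    pad₀ true = refl
    pad₀ false = refl
    pad₁ : ∀ t → count₀ (rightPad t) ≡ bit t
    pad₁ true = refl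
    pad₁ false = refl

count₁-lift : ∀ v → count₁ (lift v) ≡ bit (padsLeft v) + (count₀ v + count₁ v)
count₁-lift v = begin
  count₁ (leftPad s ++ hw v ++ rightPad t)                 ≡⟨ count₁-++ (leftPad s) _ ⟩
  count₁ (leftPad s) + count₁ (hw v ++ rightPad t)         ≡⟨ cong (count₁ (leftPad s) +_) (count₁-++ (hw v) (rightPad t)) ⟩
  count₁ (leftPad s) + (count₁ (hw v) + count₁ (rightPad t)) ≡⟨ cong₃ (λ a b c → a + (b + c)) (pad₁ s) (count₁-hw v) (pad₀ t) ⟩
  bit s + (count₀ v + count₁ v + 0)                        ≡⟨ cong (bit s +_) (+-identityʳ _) ⟩
  bit s + (count₀ v + count₁ v)                            ∎
  where
    open ≡-Reasoning
    s : Bool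
    s = padsLeft v
    t : Bool
    t = padsRight v
    pad₁ : ∀ s → count₁ (leftPad s) ≡ bit s
    pad₁ true = refl
    pad₁ false = refl
    pad₀ : ∀ t → count₁ (rightPad t) ≡ 0
    pad₀ true = refl
    pad₀ false = refl

count₂-lift : ∀ v → count₂ (lift v) ≡ count₁ v
count₂-lift v = begin
  count₂ (leftPad s ++ hw v ++ rightPad t)                 ≡⟨ count₂-++ (leftPad s) _ ⟩
  count₂ (leftPad s) + count₂ (hw v ++ rightPad t)         ≡⟨ cong (count₂ (leftPad s) +_) (count₂-++ (hw v) (rightPad t)) ⟩
  count₂ (leftPad s) + (count₂ (hw v) + count₂ (rightPad t)) ≡⟨ cong₃ (λ a b c → a + (b + c)) (pad s) (count₂-hw v) (pad′ t) ⟩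
  count₁ v + 0                                             ≡⟨ +-identityʳ _ ⟩
  count₁ v                                                 ∎
  where
    open ≡-Reasoning
    s : Bool
    s = padsLeft v
    t : Bool
    t = padsRight v
    pad : ∀ s → count₂ (leftPad s) ≡ 0
    pad true = refl
    pad false = refl
    pad′ : ∀ t → count₂ (rightPad t) ≡ 0
    pad′ true = refl
    pad′ false = refl

padsLeft-lift : ∀ v → padsLeft (lift v) ≡ not (padsLeft v)
padsLeft-lift [] = refl
padsLeft-lift (zero ∷ v) = refl
padsLeft-lift (suc zero ∷ v) = refl
padsLeft-lift (suc (suc zero) ∷ v) = refl

bit-padsLeft-orbit : ∀ w → padsLeft w ≡ false → ∀ q → bit (padsLeft (orbit w q)) ≡ parity q
bit-padsLeft-orbit w e 0 = cong bit e
bit-padsLeft-orbit w e 1 = cong bit (trans (padsLeft-lift w) (cong not e))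
bit-padsLeft-orbit w e (suc (suc q)) = trans
  (cong bit (trans (padsLeft-lift (orbit w (suc q))) (trans (cong not (padsLeft-lift (orbit w q))) (not-involutive _))))
  (bit-padsLeft-orbit w e q)

liftLast : Letter → Letter
liftLast zero = l1
liftLast (suc zero) = l0
liftLast (suc (suc zero)) = l0

liftLast^ : ℕ → Letter → Letter
liftLast^ zero a = a
liftLast^ (suc q) a = liftLast^ q (liftLast a)

liftLast^-comm : ∀ q a → liftLast (liftLast^ q a) ≡ liftLast^ q (liftLast a)
liftLast^-comm zero a = refl
liftLast^-comm (suc q) a = liftLast^-comm q (liftLast a)

lift-∷ʳ : ∀ u a → ∃[ u' ] lift (u ∷ʳ a) ≡ u' ∷ʳ liftLast a
lift-∷ʳ u a with image-end a
  where
    image-end : ∀ a → ∃[ z ] h a ++ rightPad (isOne a) ≡ z ∷ʳ liftLast a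
    image-end zero = l0 ∷ [] , refl
    image-end (suc zero) = l2 ∷ l1 ∷ [] , refl
    image-end (suc (suc zero)) = [] , refl
... | z , e = leftPad (padsLeft (u ∷ʳ a)) ++ hw u ++ z , (begin
  leftPad s ++ hw (u ∷ʳ a) ++ rightPad (padsRight (u ∷ʳ a)) ≡⟨ cong₂ (λ x t → leftPad s ++ x ++ rightPad t) (hw-∷ʳ u a) (padsRight-∷ʳ u a) ⟩
  leftPad s ++ (hw u ++ h a) ++ rightPad (isOne a)           ≡⟨ cong (leftPad s ++_) (++-assoc (hw u) (h a) _) ⟩
  leftPad s ++ hw u ++ h a ++ rightPad (isOne a)             ≡⟨ cong (λ x → leftPad s ++ hw u ++ x) e ⟩
  leftPad s ++ hw u ++ z ∷ʳ liftLast a                       ≡⟨ cong (leftPad s ++_) (++-assoc (hw u) z _) ⟨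
  leftPad s ++ (hw u ++ z) ∷ʳ liftLast a                     ≡⟨ ++-assoc (leftPad s) (hw u ++ z) _ ⟨
  (leftPad s ++ hw u ++ z) ∷ʳ liftLast a                     ∎)
  where
    open ≡-Reasoning
    s : Bool
    s = padsLeft (u ∷ʳ a)

padsRight-orbit : ∀ u a q → padsRight (orbit (u ∷ʳ a) q) ≡ isOne (liftLast^ q a)
padsRight-orbit u a q with orbit-last q
  where
    orbit-last : ∀ q → ∃[ u' ] orbit (u ∷ʳ a) q ≡ u' ∷ʳ liftLast^ q a
    orbit-last zero = u , refl
    orbit-last (suc q) with orbit-last q
    ... | u' , e with lift-∷ʳ u' (liftLast^ q a)
    ... | u″ , e′ = u″ , trans (cong lift e) (trans e′ (cong (u″ ∷ʳ_) (liftLast^-comm q a)))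
... | u' , e = trans (cong padsRight e) (padsRight-∷ʳ u' _)

bit-isOne-liftLast^-1 : ∀ q → bit (isOne (liftLast^ q l1)) ≡ parity (suc q)
bit-isOne-liftLast^-1 0 = refl
bit-isOne-liftLast^-1 1 = refl
bit-isOne-liftLast^-1 (suc (suc q)) = bit-isOne-liftLast^-1 q

bit-isOne-liftLast^-0 : ∀ q → bit (isOne (liftLast^ q l0)) ≡ parity q
bit-isOne-liftLast^-0 0 = refl
bit-isOne-liftLast^-0 1 = refl
bit-isOne-liftLast^-0 (suc (suc q)) = bit-isOne-liftLast^-0 q

counts-orbit₁ : ∀ q → count₀ (orbit₁ (3 + q)) ≡ N₁ (1 + q) + 1 × count₁ (orbit₁ (3 + q)) ≡ N₁₀ (1 + q) + 1 ×
                      count₂ (orbit₁ (3 + q)) ≡ N₁₀ q + 1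
counts-orbit₁ zero = refl , refl , refl
counts-orbit₁ (suc q) with counts-orbit₁ q
... | e₀ , e₁ , e₂ =
  trans (count₀-lift v) (trans (cong₃ (λ a b p → a + b + p) e₀ e₂ right-pad)
    (trans (shift (N₁ (1 + q)) (N₁₀ q) (parity q)) (cong (_+ 1) (sym (N₁-suc-suc q))))) ,
  trans (count₁-lift v) (trans (cong₃ (λ p a b → p + (a + b)) left-pad e₀ e₁)
    (trans (shift′ (N₁ (1 + q)) (N₁₀ (1 + q)) (parity (suc q))) (cong (_+ 1) (sym (N₁₀-suc (suc q)))))) ,
  trans (count₂-lift v) e₁
  where
    v : List Letter
    v = orbit₁ (3 + q)
    right-pad : bit (padsRight v) ≡ parity q
    right-pad = trans (cong bit (padsRight-orbit [] l1 (3 + q))) (bit-isOne-liftLast^-1 (3 + q))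
    left-pad : bit (padsLeft v) ≡ parity (suc q)
    left-pad = bit-padsLeft-orbit (l1 ∷ []) refl (3 + q)
    shift : ∀ a b p → a + 1 + (b + 1) + p ≡ (a + b + 1 + p) + 1
    shift = solve-∀
    shift′ : ∀ a b p → p + (a + 1 + (b + 1)) ≡ (b + a + 1 + p) + 1
    shift′ = solve-∀

counts-orbit₁₀ : ∀ q → count₀ (orbit₁₀ (2 + q)) ≡ N₁₀ q + 1 × count₁ (orbit₁₀ (2 + q)) ≡ N₁ (1 + q) + 1 ×
                       count₂ (orbit₁₀ (2 + q)) ≡ N₁ q + 1
counts-orbit₁₀ zero = refl , refl , refl
counts-orbit₁₀ (suc q) with counts-orbit₁₀ q
... | e₀ , e₁ , e₂ =
  trans (count₀-lift v) (trans (cong₃ (λ a b p → a + b + p) e₀ e₂ right-pad)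
    (trans (shift (N₁₀ q) (N₁ q) (parity q)) (cong (_+ 1) (sym (N₁₀-suc q))))) ,
  trans (count₁-lift v) (trans (cong₃ (λ p a b → p + (a + b)) left-pad e₀ e₁)
    (trans (shift′ (N₁₀ q) (N₁ (1 + q)) (parity q)) (cong (_+ 1) (sym (N₁-suc-suc q))))) ,
  trans (count₂-lift v) e₁
  where
    v : List Letter
    v = orbit₁₀ (2 + q)
    right-pad : bit (padsRight v) ≡ parity q
    right-pad = trans (cong bit (padsRight-orbit (l1 ∷ []) l0 (2 + q))) (bit-isOne-liftLast^-0 (2 + q))
    left-pad : bit (padsLeft v) ≡ parity q
    left-pad = bit-padsLeft-orbit (l1 ∷ l0 ∷ []) refl (2 + q)
    shift : ∀ a b p → a + 1 + (b + 1) + p ≡ (a + b + 1 + p) + 1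
    shift = solve-∀
    shift′ : ∀ a b p → p + (a + 1 + (b + 1)) ≡ (b + a + 1 + p) + 1
    shift′ = solve-∀

-- The parities of q and q + 1 sum to 1, so A + B + C + 3 splits into two steps of the recurrences.
sum-of-counts : ∀ A B C q → A + 1 + (B + 1) + (C + 1) ≡ (A + C + 1 + parity q) + B + 1 + parity (suc q)
sum-of-counts A B C q = trans (collect A B C) (trans (cong (A + B + C + 2 +_) (sym (parity-+1 q))) (spread A B C (parity q) (parity (suc q))))
  where
    collect : ∀ A B C → A + 1 + (B + 1) + (C + 1) ≡ A + B + C + 2 + 1
    collect = solve-∀
    spread : ∀ A B C p p' → A + B + C + 2 + (p + p') ≡ (A + C + 1 + p) + B + 1 + p'
    spread = solve-∀

length-orbit₁ : ∀ q → length (orbit₁ q) ≡ N₁ q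
length-orbit₁ 0 = refl
length-orbit₁ 1 = refl
length-orbit₁ 2 = refl
length-orbit₁ (suc (suc (suc q))) with counts-orbit₁ q
... | e₀ , e₁ , e₂ = begin
  length (orbit₁ (3 + q))                                              ≡⟨ length≡counts (orbit₁ (3 + q)) ⟩
  count₀ (orbit₁ (3 + q)) + count₁ (orbit₁ (3 + q)) + count₂ (orbit₁ (3 + q)) ≡⟨ cong₃ (λ a b c → a + b + c) e₀ e₁ e₂ ⟩
  N₁ (1 + q) + 1 + (N₁₀ (1 + q) + 1) + (N₁₀ q + 1)                     ≡⟨ sum-of-counts (N₁ (1 + q)) (N₁₀ (1 + q)) (N₁₀ q) q ⟩
  (N₁ (1 + q) + N₁₀ q + 1 + parity q) + N₁₀ (1 + q) + 1 + parity (suc q) ≡⟨ cong (λ x → x + N₁₀ (1 + q) + 1 + parity (suc q)) (N₁-suc-suc q) ⟨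
  N₁ (2 + q) + N₁₀ (1 + q) + 1 + parity (suc q)                         ≡⟨ N₁-suc-suc (suc q) ⟨
  N₁ (3 + q)                                                            ∎
  where open ≡-Reasoning

length-orbit₁₀ : ∀ q → length (orbit₁₀ q) ≡ N₁₀ q
length-orbit₁₀ 0 = refl
length-orbit₁₀ 1 = refl
length-orbit₁₀ (suc (suc q)) with counts-orbit₁₀ q
... | e₀ , e₁ , e₂ = begin
  length (orbit₁₀ (2 + q))                                             ≡⟨ length≡counts (orbit₁₀ (2 + q)) ⟩
  count₀ (orbit₁₀ (2 + q)) + count₁ (orbit₁₀ (2 + q)) + count₂ (orbit₁₀ (2 + q)) ≡⟨ cong₃ (λ a b c → a + b + c) e₀ e₁ e₂ ⟩
  N₁₀ q + 1 + (N₁ (1 + q) + 1) + (N₁ q + 1)                           ≡⟨ sum-of-counts (N₁₀ q) (N₁ (1 + q)) (N₁ q) q ⟩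
  (N₁₀ q + N₁ q + 1 + parity q) + N₁ (1 + q) + 1 + parity (suc q)      ≡⟨ cong (λ x → x + N₁ (1 + q) + 1 + parity (suc q)) (N₁₀-suc q) ⟨
  N₁₀ (1 + q) + N₁ (1 + q) + 1 + parity (suc q)                         ≡⟨ N₁₀-suc (suc q) ⟨
  N₁₀ (2 + q)                                                           ∎
  where open ≡-Reasoning

occurs-in-hpow-4 : ∀ i n → Occurs (take n (drop i (hpow 4)))
occurs-in-hpow-4 i n = 4 , take i (hpow 4) , drop n (drop i (hpow 4)) ,
  sym (trans (cong (take i (hpow 4) ++_) (take++drop≡id n (drop i (hpow 4)))) (take++drop≡id i (hpow 4)))

-- hpow 4 = 012102101021
bispecial-1 : Bispecialᵒ (l1 ∷ [])
bispecial-1 = (l0 , l2 , (λ ()) , occurs-in-hpow-4 0 2 , occurs-in-hpow-4 2 2) ,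
              (l0 , l2 , (λ ()) , occurs-in-hpow-4 3 2 , occurs-in-hpow-4 1 2)

bispecial-10 : Bispecialᵒ (l1 ∷ l0 ∷ [])
bispecial-10 = (l0 , l2 , (λ ()) , occurs-in-hpow-4 7 3 , occurs-in-hpow-4 2 3) ,
               (l1 , l2 , (λ ()) , occurs-in-hpow-4 6 3 , occurs-in-hpow-4 3 3)

lift-nonempty : ∀ v → lift v ≢ []
lift-nonempty [] ()
lift-nonempty (zero ∷ v) ()
lift-nonempty (suc zero ∷ v) ()
lift-nonempty (suc (suc zero) ∷ v) ()

orbit-bispecial : ∀ w q → w ≢ [] → Bispecialᵒ w → Bispecialᵒ (orbit w q)
orbit-bispecial w zero _ bs = bs
orbit-bispecial w (suc q) w≢[] bs = lift-bispecial (orbit w q) (nonempty q) (orbit-bispecial w q w≢[] bs)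
  where
    nonempty : ∀ q → orbit w q ≢ []
    nonempty zero = w≢[]
    nonempty (suc q) = lift-nonempty (orbit w q)

bispecial⇒bispecialᵒ : ∀ {w} → Bispecial w → Bispecialᵒ w
bispecial⇒bispecialᵒ ((b , b' , b≢b' , fb , fb') , (a , a' , a≢a' , fa , fa')) =
  (a , a' , a≢a' , factor⇒occurs fa , factor⇒occurs fa') , (b , b' , b≢b' , factor⇒occurs fb , factor⇒occurs fb')

bispecialᵒ⇒bispecial : ∀ {w} → Bispecialᵒ w → Bispecial w
bispecialᵒ⇒bispecial ((a , a' , a≢a' , oa , oa') , (b , b' , b≢b' , ob , ob')) =
  (b , b' , b≢b' , occurs⇒factor ob , occurs⇒factor ob') , (a , a' , a≢a' , occurs⇒factor oa , occurs⇒factor oa')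

repP-length-orbit₁ : ∀ q → repP (length (orbit₁ q)) ≡ dropLeadingZeros (digits₁ q)
repP-length-orbit₁ q = trans (cong repP (length-orbit₁ q)) (repP-value (digits₁ q) (admissible-digits₁ q) (N₁-pos q))

repP-length-orbit₁₀ : ∀ q → repP (length (orbit₁₀ q)) ≡ dropLeadingZeros (digits₁₀ q)
repP-length-orbit₁₀ q = trans (cong repP (length-orbit₁₀ q)) (repP-value (digits₁₀ q) (admissible-digits₁₀ q) (N₁₀-pos q))

length-orbit₁-repP : ∀ N q → repP N ≡ dropLeadingZeros (digits₁ q) → length (orbit₁ q) ≡ N
length-orbit₁-repP N q e =
  trans (length-orbit₁ q) (sym (trans (sym (value-repP N)) (trans (cong value e) (value-dropLeadingZeros (digits₁ q)))))

length-orbit₁₀-repP : ∀ N q → repP N ≡ dropLeadingZeros (digits₁₀ q) → length (orbit₁₀ q) ≡ N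
length-orbit₁₀-repP N q e =
  trans (length-orbit₁₀ q) (sym (trans (sym (value-repP N)) (trans (cong value e) (value-dropLeadingZeros (digits₁₀ q)))))

theorem7 : (n : ℕ) → HasBispecialOfLength (suc n) ⇔ InL (repP (suc n))
theorem7 n = mk⇔ to from
  where
    to : HasBispecialOfLength (suc n) → InL (repP (suc n))
    to (w , len , bis) with bispecial-classification (length w) w ≤-refl w≢[] (bispecial⇒bispecialᵒ bis)
      where
        w≢[] : w ≢ []
        w≢[] refl = 0≢1+n len
    ... | q , inj₁ refl = subst InL (trans (sym (repP-length-orbit₁ q)) (cong repP len)) (InL-digits₁ q)
    ... | q , inj₂ refl = subst InL (trans (sym (repP-length-orbit₁₀ q)) (cong repP len)) (InL-digits₁₀ q)
    from : InL (repP (suc n)) → HasBispecialOfLength (suc n)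
    from inL with InL-inversion inL
    ... | q , inj₁ e = orbit₁ q , length-orbit₁-repP (suc n) q e ,
                       bispecialᵒ⇒bispecial (orbit-bispecial (l1 ∷ []) q (λ ()) bispecial-1)
    ... | q , inj₂ e = orbit₁₀ q , length-orbit₁₀-repP (suc n) q e ,
                       bispecialᵒ⇒bispecial (orbit-bispecial (l1 ∷ l0 ∷ []) q (λ ()) bispecial-10)
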